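{- Let $(\mathcal{G},\mathcal{I})$ be a $k$-exchange system, $f:2^{\mathcal{G}}\to\mathbb{R}_{+}$ a monotone submodular function, and $\epsilon\in(0,1)$. Let $S$ be the solution returned by the Non-Oblivious Local Search algorithm described in the context, and let $O\in\mathcal{I}$ be an independent set maximizing $f$ over $\mathcal{I}$. Then $$\Big(\frac{k+3}{2}+\epsilon\Big)f(S)\ \ge\ f(O).$$
   Context: An independence system $(\mathcal{G},\mathcal{I})$: finite ground set $\mathcal{G}$, $n=|\mathcal{G}|$, nonempty downward-closed $\mathcal{I}\subseteq 2^{\mathcal{G}}$. It is a $k$-exchange system ($k\ge1$ an integer) if for all $A,B\in\mathcal{I}$ there is a collection $\{Y_e\subseteq B\setminus A: e\in A\setminus B\}$ with (K1) $|Y_e|\le k$; (K2) each $x\in B\setminus A$ lies in at most $k$ sets $Y_e$; (K3) for every $C\subseteq A\setminus B$, $(B\setminus\bigcup_{e\in C}Y_e)\cup C\in\mathcal{I}$. Given a current solution $S\in\mathcal{I}$, a $k$-replacement is a pair $(A,B)$ with $B\subseteq S$, $A\subseteq\mathcal{G}\setminus(S\setminus B)$, $|A|\le k$, $|B|\le k^2-k+1$, and $(S\setminus B)\cup A\in\mathcal{I}$. Algorithm (Non-Oblivious Local Search), with oracle access to $\mathcal{I}$ (membership) and $f$ (values): let $S_{init}=\{e^*\}$ where $e^*$ maximizes $f(\{e\})$; $\delta=(1+\frac{k+3}{2\epsilon})^{ -1}$, $\alpha=f(S_{init})\delta/n$; start with $S=S_{init}$ and an arbitrary total order $\prec$ on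 $\mathcal{G}$. In each iteration: list $S=\{s_1,\dots,s_m\}$ in $\prec$-order, $S_i=\{s_1,\dots,s_i\}$, set $w(s_i)=\lfloor (f(S_{i-1}\cup\{s_i\})-f(S_{i-1}))/\alpha\rfloor\alpha$. For each $k$-replacement $(A,B)$, list $A=\{a_1,\dots,a_r\}$ in $\prec$-order, $A_i=\{a_1,\dots,a_i\}$, set $w_{(A,B)}(a_i)=\lfloor (f((S\setminus B)\cup A_{i-1}\cup\{a_i\})-f((S\setminus B)\cup A_{i-1}))/\alpha\rfloor\alpha$. If $\sum_{a\in A}w_{(A,B)}(a)^2>\sum_{b\in B}w(b)^2$, replace $\prec$ by the order $\prec'$ in which every element of $S\setminus B$ precedes every element of $A$ and all other pairs are ordered as in $\prec$, replace $S$ by $(S\setminus B)\cup A$, and start the next iteration. If no $k$-replacement satisfies the condition, return $S$. -}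

module Defs where

open import Level using (0ℓ)
open import Data.Bool using (Bool; true; false; _∧_; _∨_; if_then_else_)
open import Data.Nat as ℕ using (ℕ; zero; suc; _<ᵇ_)
open import Data.Integer as ℤ using (ℤ; +_; -[1+_])
open import Data.Fin using (Fin; zero; suc)
open import Data.Fin.Subset using (Subset; _∈_; _⊆_; _─_; _∪_; _∩_; ∁; ⁅_⁆; ∣_∣)
open import Data.Vec using (lookup; tabulate)
open import Data.Product using (Σ; ∃; ∃₂; _×_; _,_)
open import Data.Sum using (_⊎_)
open import Function using (_∘_)
open import Function.Definitions using (Injective)
open import Relation.Nullary using (¬_)
open import Relation.Binary.PropositionalEquality using (_≡_; _≢_)
open import Relation.Binary.Structures using (IsStrictTotalOrder)
open import Relation.Binary.Construct.Closure.ReflexiveTransitive using (Star)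
open import Algebra.Structures using (IsCommutativeRing)

record OrderedField : Set₁ where
  infixl 6 _+_
  infixl 7 _*_
  infix  4 _<_
  field
    R   : Set
    0ℝ  : R
    1ℝ  : R
    _+_ : R → R → R
    _*_ : R → R → R
    -_  : R → R
    _⁻¹ : R → R
    _<_ : R → R → Set
    isCommutativeRing : IsCommutativeRing _≡_ _+_ _*_ -_ 0ℝ 1ℝ
    0≢1       : 0ℝ ≢ 1ℝ
    ⁻¹-inverse : ∀ x → x ≢ 0ℝ → x * (x ⁻¹) ≡ 1ℝ
    0⁻¹        : 0ℝ ⁻¹ ≡ 0ℝ          -- total-inverse convention
    <-isStrictTotalOrder : IsStrictTotalOrder _≡_ _<_
    +-monoˡ-<  : ∀ {x y} z → x < y → x + z < y + z
    *-pos      : ∀ {x y} → 0ℝ < x → 0ℝ < y → 0ℝ < x * y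

  infix 4 _≤_
  _≤_ : R → R → Set
  x ≤ y = x < y ⊎ x ≡ y

  infixl 6 _-_
  _-_ : R → R → R
  x - y = x + (- y)

  infixl 7 _/_
  _/_ : R → R → R
  x / y = x * (y ⁻¹)

  fromℕ : ℕ → R
  fromℕ zero    = 0ℝ
  fromℕ (suc m) = 1ℝ + fromℕ m

  fromℤ : ℤ → R
  fromℤ (+ m)     = fromℕ m
  fromℤ -[1+ m ]  = - (1ℝ + fromℕ m)

record RealField : Set₁ where
  field
    orderedField : OrderedField
  open OrderedField orderedField public
  field
    complete : (P : R → Set) → ∃ P → (∃ λ b → ∀ x → P x → x ≤ b) →
               ∃ λ s → (∀ x → P x → x ≤ s) × (∀ b → (∀ x → P x → x ≤ b) → s ≤ b)
    ⌊_⌋      : R → ℤ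
    ⌊⌋-lower : ∀ x → fromℤ ⌊ x ⌋ ≤ x
    ⌊⌋-upper : ∀ x → x < fromℤ ⌊ x ⌋ + 1ℝ

anyFin : ∀ {n} → (Fin n → Bool) → Bool
anyFin {zero}  g = false
anyFin {suc n} g = g zero ∨ anyFin (g ∘ suc)

⋃[_]_ : ∀ {n} → Subset n → (Fin n → Subset n) → Subset n
⋃[ C ] Y = tabulate λ x → anyFin λ e → lookup C e ∧ lookup (Y e) x

record IndependenceSystem (n : ℕ) (ℐ : Subset n → Set) : Set where
  field
    nonempty    : ∃ ℐ
    downClosed  : ∀ {A B} → A ⊆ B → ℐ B → ℐ A

record ExchangeSystem (k n : ℕ) (ℐ : Subset n → Set) : Set where
  field
    isIndependenceSystem : IndependenceSystem n ℐ
    exchange : ∀ A B → ℐ A → ℐ B →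
      ∃ λ (Y : Fin n → Subset n) →
        (∀ e → e ∈ A ─ B → (Y e ⊆ B ─ A) × ∣ Y e ∣ ℕ.≤ k) ×
        -- (K2) each x ∈ B ∖ A lies in at most k of the sets Y_e (e ∈ A ∖ B)
        (∀ x → x ∈ B ─ A →
           ∣ tabulate (λ e → lookup (A ─ B) e ∧ lookup (Y e) x) ∣ ℕ.≤ k) ×
        (∀ C → C ⊆ A ─ B → ℐ ((B ─ (⋃[ C ] Y)) ∪ C))

module SetFunctions (ℝ : RealField) where
  open RealField ℝ

  NonNegative : ∀ {n} → (Subset n → R) → Set
  NonNegative f = ∀ X → 0ℝ ≤ f X

  Monotone : ∀ {n} → (Subset n → R) → Set
  Monotone f = ∀ {X Y} → X ⊆ Y → f X ≤ f Y

  Submodular : ∀ {n} → (Subset n → R) → Set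
  Submodular f = ∀ X Y → f (X ∪ Y) + f (X ∩ Y) ≤ f X + f Y

  delta : ℕ → R → R
  delta k ε = (1ℝ + fromℕ (k ℕ.+ 3) / (fromℕ 2 * ε)) ⁻¹

  alpha : ∀ {n} → (Subset n → R) → Fin n → ℕ → R → R
  alpha {n} f e* k ε = f ⁅ e* ⁆ * delta k ε / fromℕ n

-- The Non-Oblivious Local Search algorithm, as a transition system.
-- A total order ≺ on the ground set is represented by an injective
-- rank function (x ≺ y iff rank x < rank y).

module NOLS (ℝ : RealField) {n : ℕ} (ℐ : Subset n → Set) (f : Subset n → RealField.R ℝ)
            (k : ℕ) (α : RealField.R ℝ) where
  open RealField ℝ

  Rank : Set
  Rank = Fin n → ℕ

  before : Rank → Subset n → Fin n → Subset n
  before rank X s = tabulate λ t → lookup X t ∧ (rank t <ᵇ rank s)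

  round : R → R
  round x = fromℤ ⌊ x / α ⌋ * α

  w : Subset n → Rank → Fin n → R
  w S rank s = round (f (before rank S s ∪ ⁅ s ⁆) - f (before rank S s))

  wRep : Subset n → Rank → Subset n → Subset n → Fin n → R
  wRep S rank A B a =
    round (f ((S ─ B) ∪ before rank A a ∪ ⁅ a ⁆) - f ((S ─ B) ∪ before rank A a))

  sumFin : ∀ {m} → (Fin m → R) → R
  sumFin {zero}  g = 0ℝ
  sumFin {suc m} g = g zero + sumFin (g ∘ suc)

  sumOver : Subset n → (Fin n → R) → R
  sumOver X g = sumFin λ x → if lookup X x then g x else 0ℝ

  sq : R → R
  sq x = x * x

  IsReplacement : Subset n → Subset n → Subset n → Set
  IsReplacement S A B =
    B ⊆ S × A ⊆ ∁ (S ─ B) × ∣ A ∣ ℕ.≤ k × ∣ B ∣ ℕ.≤ k ℕ.* k ℕ.∸ k ℕ.+ 1 ×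
    ℐ ((S ─ B) ∪ A)

  Improving : Subset n → Rank → Subset n → Subset n → Set
  Improving S rank A B =
    sumOver B (sq ∘ w S rank) < sumOver A (sq ∘ wRep S rank A B)

  -- ≺' : every element of S∖B precedes every element of A, all other
  -- pairs ordered as in ≺.
  NewOrder : Subset n → Subset n → Subset n → Rank → Rank → Set
  NewOrder S A B rank rank' = ∀ x y → x ≢ y →
    let P = (x ∈ S ─ B × y ∈ A) ⊎
            (¬ (x ∈ S ─ B × y ∈ A) × ¬ (x ∈ A × y ∈ S ─ B) × rank x ℕ.< rank y)
    in (rank' x ℕ.< rank' y → P) × (P → rank' x ℕ.< rank' y)

  record State : Set where
    constructor ⟨_,_,_⟩
    field
      sol     : Subset n
      rank    : Rank
      rankInj : Injective _≡_ _≡_ rank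
  open State public

  Step : State → State → Set
  Step σ σ' = ∃₂ λ A B →
    IsReplacement (sol σ) A B × Improving (sol σ) (rank σ) A B ×
    sol σ' ≡ (sol σ ─ B) ∪ A × NewOrder (sol σ) A B (rank σ) (rank σ')

  Terminal : State → Set
  Terminal σ = ∀ A B → IsReplacement (sol σ) A B → ¬ Improving (sol σ) (rank σ) A B

  Returns : Fin n → (rank₀ : Rank) → Injective _≡_ _≡_ rank₀ → Subset n → Set
  Returns e* rank₀ inj S = ∃ λ σ →
    Star Step ⟨ ⁅ e* ⁆ , rank₀ , inj ⟩ σ × Terminal σ × sol σ ≡ S

{-# OPTIONS --safe #-}
module Submission where

-- Let S be the returned local optimum and O an optimum. The rounded weights w of S telescope to
-- at most f S, and the gains v of the elements of O ∖ S added on top of S telescope to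
-- f (S ∪ O) - f S ≥ f O - f S. The k-exchange property provides sets Y o ⊆ S ∖ O; grouping the
-- elements o of O ∖ S by the heaviest element s of Y o, each group together with the union of its
-- sets Y o is a k-replacement. Local optimality bounds the squared weights of such a swap, and
-- 2 c y ≤ y² + c² with c = w s turns this into 2 Σ v ≤ w s + Σ Σ_{Y o} w up to rounding errors α.
-- Summing over the groups, each element of S being in at most k sets Y o, gives
-- 2 (f O - f S) ≤ (k + 1) f S + 2 n α, and n α = δ f {e*} ≤ δ f O; solving for f O gives the bound.

open import Defs
open import Data.Nat using (ℕ) renaming (_≤_ to _≤ℕ_; _+_ to _+ℕ_)
open import Data.Fin using (Fin)
open import Data.Fin.Subset using (Subset; ⁅_⁆)
open import Function.Definitions using (Injective)
open import Relation.Binary.PropositionalEquality using (_≡_)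
open import Data.Product using (_,_)
open import Relation.Binary.PropositionalEquality using (refl)

module OrderedFieldProperties (ℝ : RealField) where
  open RealField ℝ
  open import Algebra.Bundles using (CommutativeRing)
  open import Algebra.Solver.Ring.AlmostCommutativeRing
    using (AlmostCommutativeRing; fromCommutativeRing; _-Raw-AlmostCommutative⟶_)
  import Algebra.Solver.Ring
  open import Data.Maybe using (Maybe; just; nothing)
  open import Data.Nat as ℕ using (zero; suc)
  open import Data.Fin using (Fin)
  import Data.Nat.Properties as ℕ
  open import Data.Integer as ℤ using (-[1+_]; _⊖_; _◃_) renaming (+_ to pos)
  import Data.Integer.Properties as ℤ
  open import Data.Sign as Sign using ()
  open import Data.Sum using (inj₁; inj₂)
  open import Data.Product using (_,_)
  open import Data.Empty using (⊥-elim)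
  open import Relation.Nullary using (yes; no; ¬_)
  open import Relation.Binary.Bundles using (StrictTotalOrder)
  open import Relation.Binary.Definitions using (tri<; tri≈; tri>)
  open import Relation.Binary.PropositionalEquality
  import Relation.Binary.Reasoning.StrictPartialOrder
  import Relation.Binary.Construct.StrictToNonStrict _≡_ _<_ as NonStrict

  commutativeRing : CommutativeRing _ _
  commutativeRing = record { isCommutativeRing = isCommutativeRing }

  open CommutativeRing commutativeRing public
    using (+-assoc; +-comm; *-assoc; *-comm; +-identityˡ; +-identityʳ; *-identityˡ; *-identityʳ;
           distribˡ; distribʳ; -‿inverseʳ; zeroˡ; zeroʳ)
  open import Algebra.Properties.Ring (CommutativeRing.ring commutativeRing)
    using (-‿involutive; -0#≈0#; -‿distribˡ-*; -‿distribʳ-*; -‿anti-homo-+)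

  fromℕ-+ : ∀ m n → fromℕ (m ℕ.+ n) ≡ fromℕ m + fromℕ n
  fromℕ-+ zero    n = sym (+-identityˡ _)
  fromℕ-+ (suc m) n = trans (cong (1ℝ +_) (fromℕ-+ m n)) (sym (+-assoc _ _ _))

  fromℕ-* : ∀ m n → fromℕ (m ℕ.* n) ≡ fromℕ m * fromℕ n
  fromℕ-* zero    n = sym (zeroˡ _)
  fromℕ-* (suc m) n = begin
    fromℕ (n ℕ.+ m ℕ.* n)            ≡⟨ fromℕ-+ n (m ℕ.* n) ⟩
    fromℕ n + fromℕ (m ℕ.* n)        ≡⟨ cong₂ _+_ (sym (*-identityˡ _)) (fromℕ-* m n) ⟩
    1ℝ * fromℕ n + fromℕ m * fromℕ n ≡⟨ sym (distribʳ _ _ _) ⟩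
    (1ℝ + fromℕ m) * fromℕ n         ∎
    where open ≡-Reasoning

  fromℤ-neg : ∀ i → fromℤ (ℤ.- i) ≡ - fromℤ i
  fromℤ-neg (pos zero)    = sym -0#≈0#
  fromℤ-neg (pos (suc n)) = refl
  fromℤ-neg -[1+ n ]      = sym (-‿involutive _)

  private
    shift-difference : ∀ a b c → a - b ≡ (c + a) - (c + b)
    shift-difference a b c = begin
      a - b                       ≡⟨ sym (+-identityˡ _) ⟩
      0ℝ + (a - b)                ≡⟨ cong (_+ (a - b)) (sym (-‿inverseʳ c)) ⟩
      (c - c) + (a - b)           ≡⟨ +-assoc _ _ _ ⟩
      c + (- c + (a - b))         ≡⟨ cong (c +_) (trans (sym (+-assoc _ _ _))
                                       (trans (cong (_+ - b) (+-comm _ _)) (+-assoc _ _ _))) ⟩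
      c + (a + (- c - b))         ≡⟨ sym (+-assoc _ _ _) ⟩
      (c + a) + (- c - b)         ≡⟨ cong ((c + a) +_) (sym (-‿anti-homo-+ _ _)) ⟩
      (c + a) + - (b + c)         ≡⟨ cong (λ z → (c + a) - z) (+-comm _ _) ⟩
      (c + a) - (c + b)           ∎
      where open ≡-Reasoning

  fromℤ-⊖ : ∀ m n → fromℤ (m ⊖ n) ≡ fromℕ m - fromℕ n
  fromℤ-⊖ zero    zero    = sym (-‿inverseʳ 0ℝ)
  fromℤ-⊖ (suc m) zero    = sym (trans (cong (fromℕ (suc m) +_) -0#≈0#) (+-identityʳ _))
  fromℤ-⊖ zero    (suc n) = sym (+-identityˡ _)
  fromℤ-⊖ (suc m) (suc n) = begin
    fromℤ (suc m ⊖ suc n) ≡⟨ cong fromℤ (ℤ.[1+m]⊖[1+n]≡m⊖n m n) ⟩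
    fromℤ (m ⊖ n)         ≡⟨ fromℤ-⊖ m n ⟩
    fromℕ m - fromℕ n     ≡⟨ shift-difference _ _ 1ℝ ⟩
    fromℕ (suc m) - fromℕ (suc n) ∎
    where open ≡-Reasoning

  fromℤ-+◃ : ∀ m → fromℤ (Sign.+ ◃ m) ≡ fromℕ m
  fromℤ-+◃ zero    = refl
  fromℤ-+◃ (suc m) = refl

  fromℤ--◃ : ∀ m → fromℤ (Sign.- ◃ m) ≡ - fromℕ m
  fromℤ--◃ zero    = sym -0#≈0#
  fromℤ--◃ (suc m) = refl

  fromℤ-+ : ∀ i j → fromℤ (i ℤ.+ j) ≡ fromℤ i + fromℤ j
  fromℤ-+ (pos m)  (pos n)  = fromℕ-+ m n
  fromℤ-+ (pos m)  -[1+ n ] = fromℤ-⊖ m (suc n)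
  fromℤ-+ -[1+ m ] (pos n)  = trans (fromℤ-⊖ n (suc m)) (+-comm _ _)
  fromℤ-+ -[1+ m ] -[1+ n ] = begin
    - (1ℝ + (1ℝ + fromℕ (m ℕ.+ n)))          ≡⟨ cong (λ z → - (1ℝ + (1ℝ + z))) (fromℕ-+ m n) ⟩
    - (1ℝ + (1ℝ + (fromℕ m + fromℕ n)))      ≡⟨ cong -_ (regroup 1ℝ (fromℕ m) (fromℕ n)) ⟩
    - ((1ℝ + fromℕ m) + (1ℝ + fromℕ n))      ≡⟨ trans (-‿anti-homo-+ _ _) (+-comm _ _) ⟩
    - (1ℝ + fromℕ m) + - (1ℝ + fromℕ n)      ∎
    where
    open ≡-Reasoning
    regroup : ∀ a b c → a + (a + (b + c)) ≡ (a + b) + (a + c)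
    regroup a b c = begin
      a + (a + (b + c)) ≡⟨ cong (a +_) (trans (sym (+-assoc a b c)) (trans (cong (_+ c) (+-comm a b)) (+-assoc b a c))) ⟩
      a + (b + (a + c)) ≡⟨ sym (+-assoc a b (a + c)) ⟩
      (a + b) + (a + c) ∎

  fromℤ-* : ∀ i j → fromℤ (i ℤ.* j) ≡ fromℤ i * fromℤ j
  fromℤ-* (pos m)  (pos n)  = trans (fromℤ-+◃ (m ℕ.* n)) (fromℕ-* m n)
  fromℤ-* (pos m)  -[1+ n ] =
    trans (fromℤ--◃ (m ℕ.* suc n)) (trans (cong -_ (fromℕ-* m (suc n))) (-‿distribʳ-* _ _))
  fromℤ-* -[1+ m ] (pos n)  =
    trans (fromℤ--◃ (suc m ℕ.* n)) (trans (cong -_ (fromℕ-* (suc m) n)) (-‿distribˡ-* _ _))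
  fromℤ-* -[1+ m ] -[1+ n ] =
    trans (fromℤ-+◃ (suc m ℕ.* suc n)) (trans (fromℕ-* (suc m) (suc n))
      (trans (sym (-‿involutive _)) (trans (cong -_ (-‿distribˡ-* _ _)) (-‿distribʳ-* _ _))))

  almostCommutativeRing : AlmostCommutativeRing _ _
  almostCommutativeRing = fromCommutativeRing commutativeRing

  fromℤ-morphism : ℤ.+-*-rawRing -Raw-AlmostCommutative⟶ almostCommutativeRing
  fromℤ-morphism = record
    { ⟦_⟧ = fromℤ ; +-homo = fromℤ-+ ; *-homo = fromℤ-* ; -‿homo = fromℤ-neg
    ; 0-homo = refl ; 1-homo = +-identityʳ 1ℝ }

  fromℤ-≟ : ∀ i j → Maybe (fromℤ i ≡ fromℤ j)
  fromℤ-≟ i j with i ℤ.≟ j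
  ... | yes refl = just refl
  ... | no _     = nothing

  open Algebra.Solver.Ring ℤ.+-*-rawRing almostCommutativeRing fromℤ-morphism fromℤ-≟ public
    using (solve; _:+_; _:*_; :-_; _:-_; _:=_; con)

  strictTotalOrder : StrictTotalOrder _ _ _
  strictTotalOrder = record { isStrictTotalOrder = <-isStrictTotalOrder }

  open StrictTotalOrder strictTotalOrder public using (compare; strictPartialOrder)
  open StrictTotalOrder strictTotalOrder using (irrefl) renaming (trans to <-trans)

  module ≤-Reasoning = Relation.Binary.Reasoning.StrictPartialOrder strictPartialOrder

  <-irrefl : ∀ {x} → ¬ (x < x)
  <-irrefl = irrefl refl

  ≤-refl : ∀ {x} → x ≤ x
  ≤-refl = inj₂ refl

  ≤-reflexive : ∀ {x y} → x ≡ y → x ≤ y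
  ≤-reflexive = inj₂

  ≤-trans : ∀ {x y z} → x ≤ y → y ≤ z → x ≤ z
  ≤-trans = NonStrict.trans isEquivalence (resp₂ _<_) <-trans

  ≤-antisym : ∀ {x y} → x ≤ y → y ≤ x → x ≡ y
  ≤-antisym = NonStrict.antisym isEquivalence <-trans irrefl

  <-≤-trans : ∀ {x y z} → x < y → y ≤ z → x < z
  <-≤-trans = NonStrict.<-≤-trans <-trans (subst (_ <_))

  ≤-<-trans : ∀ {x y z} → x ≤ y → y < z → x < z
  ≤-<-trans = NonStrict.≤-<-trans sym <-trans (subst (_< _))

  ≮⇒≥ : ∀ {x y} → ¬ (x < y) → y ≤ x
  ≮⇒≥ {x} {y} x≮y with compare x y
  ... | tri< x<y _ _ = ⊥-elim (x≮y x<y)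
  ... | tri≈ _ x≡y _ = inj₂ (sym x≡y)
  ... | tri> _ _ y<x = inj₁ y<x

  ≤⇒≯ : ∀ {x y} → x ≤ y → ¬ (y < x)
  ≤⇒≯ x≤y y<x = <-irrefl (≤-<-trans x≤y y<x)

  +-monoˡ-≤ : ∀ {x y} z → x ≤ y → x + z ≤ y + z
  +-monoˡ-≤ z (inj₁ x<y)  = inj₁ (+-monoˡ-< z x<y)
  +-monoˡ-≤ z (inj₂ refl) = ≤-refl

  +-monoʳ-≤ : ∀ {x y} z → x ≤ y → z + x ≤ z + y
  +-monoʳ-≤ {x} {y} z x≤y = subst₂ _≤_ (+-comm x z) (+-comm y z) (+-monoˡ-≤ z x≤y)

  +-mono-≤ : ∀ {a b c d} → a ≤ b → c ≤ d → a + c ≤ b + d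
  +-mono-≤ {b = b} {c} a≤b c≤d = ≤-trans (+-monoˡ-≤ c a≤b) (+-monoʳ-≤ b c≤d)

  x≤y⇒0≤y-x : ∀ {x y} → x ≤ y → 0ℝ ≤ y - x
  x≤y⇒0≤y-x {x} {y} x≤y = subst (_≤ y - x) (-‿inverseʳ x) (+-monoˡ-≤ (- x) x≤y)

  x<y⇒0<y-x : ∀ {x y} → x < y → 0ℝ < y - x
  x<y⇒0<y-x {x} {y} x<y = subst (_< y - x) (-‿inverseʳ x) (+-monoˡ-< (- x) x<y)

  private
    y-x+x≡y : ∀ x y → (y - x) + x ≡ y
    y-x+x≡y = solve 2 (λ x y → (y :- x) :+ x := y) refl

  0≤y-x⇒x≤y : ∀ {x y} → 0ℝ ≤ y - x → x ≤ y
  0≤y-x⇒x≤y {x} {y} p = subst₂ _≤_ (+-identityˡ x) (y-x+x≡y x y) (+-monoˡ-≤ x p)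

  0<y-x⇒x<y : ∀ {x y} → 0ℝ < y - x → x < y
  0<y-x⇒x<y {x} {y} p = subst₂ _<_ (+-identityˡ x) (y-x+x≡y x y) (+-monoˡ-< x p)

  ≤-viaDifference : ∀ {x y} d → y - x ≡ d → 0ℝ ≤ d → x ≤ y
  ≤-viaDifference d y-x≡d 0≤d = 0≤y-x⇒x≤y (subst (0ℝ ≤_) (sym y-x≡d) 0≤d)

  <-viaDifference : ∀ {x y} d → y - x ≡ d → 0ℝ < d → x < y
  <-viaDifference d y-x≡d 0<d = 0<y-x⇒x<y (subst (0ℝ <_) (sym y-x≡d) 0<d)

  x-z≤y⇒x≤y+z : ∀ {x y z} → x - z ≤ y → x ≤ y + z
  x-z≤y⇒x≤y+z {x} {y} {z} x-z≤y =
    ≤-viaDifference (y - (x - z)) (solve 3 (λ x y z → (y :+ z) :- x := y :- (x :- z)) refl x y z) (x≤y⇒0≤y-x x-z≤y)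

  +-cancelʳ-≤ : ∀ {x y} z → x + z ≤ y + z → x ≤ y
  +-cancelʳ-≤ {x} {y} z x+z≤y+z =
    ≤-viaDifference ((y + z) - (x + z)) (solve 3 (λ x y z → y :- x := (y :+ z) :- (x :+ z)) refl x y z) (x≤y⇒0≤y-x x+z≤y+z)

  x-y≤x : ∀ {x y} → 0ℝ ≤ y → x - y ≤ x
  x-y≤x {x} {y} 0≤y = ≤-viaDifference y (solve 2 (λ x y → x :- (x :- y) := y) refl x y) 0≤y

  +-nonNeg : ∀ {a b} → 0ℝ ≤ a → 0ℝ ≤ b → 0ℝ ≤ a + b
  +-nonNeg {a} 0≤a 0≤b =
    ≤-trans (subst (_≤ a + 0ℝ) (+-identityʳ 0ℝ) (+-monoˡ-≤ 0ℝ 0≤a)) (+-monoʳ-≤ a 0≤b)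

  x≤x+y : ∀ {x y} → 0ℝ ≤ y → x ≤ x + y
  x≤x+y {x} 0≤y = subst (_≤ x + _) (+-identityʳ x) (+-monoʳ-≤ x 0≤y)

  +-pos-nonNeg : ∀ {a b} → 0ℝ < a → 0ℝ ≤ b → 0ℝ < a + b
  +-pos-nonNeg {a} {b} 0<a 0≤b = <-≤-trans 0<a (subst (_≤ a + b) (+-identityʳ a) (+-monoʳ-≤ a 0≤b))

  *-nonNeg : ∀ {a b} → 0ℝ ≤ a → 0ℝ ≤ b → 0ℝ ≤ a * b
  *-nonNeg     (inj₁ 0<a)  (inj₁ 0<b)  = inj₁ (*-pos 0<a 0<b)
  *-nonNeg {a} (inj₁ _)    (inj₂ refl) = inj₂ (sym (zeroʳ a))
  *-nonNeg {b = b} (inj₂ refl) _       = inj₂ (sym (zeroˡ b))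

  *-monoʳ-≤-nonNeg : ∀ {a b} c → 0ℝ ≤ c → a ≤ b → c * a ≤ c * b
  *-monoʳ-≤-nonNeg {a} {b} c 0≤c a≤b = ≤-viaDifference (c * (b - a))
    (solve 3 (λ a b c → c :* b :- c :* a := c :* (b :- a)) refl a b c) (*-nonNeg 0≤c (x≤y⇒0≤y-x a≤b))

  *-monoˡ-≤-nonNeg : ∀ {a b} c → 0ℝ ≤ c → a ≤ b → a * c ≤ b * c
  *-monoˡ-≤-nonNeg {a} {b} c 0≤c a≤b = subst₂ _≤_ (*-comm c a) (*-comm c b) (*-monoʳ-≤-nonNeg c 0≤c a≤b)

  *-monoʳ-<-pos : ∀ {a b} c → 0ℝ < c → a < b → c * a < c * b
  *-monoʳ-<-pos {a} {b} c 0<c a<b = <-viaDifference (c * (b - a))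
    (solve 3 (λ a b c → c :* b :- c :* a := c :* (b :- a)) refl a b c) (*-pos 0<c (x<y⇒0<y-x a<b))

  *-cancelˡ-≤-pos : ∀ {a b} c → 0ℝ < c → c * a ≤ c * b → a ≤ b
  *-cancelˡ-≤-pos c 0<c ca≤cb = ≮⇒≥ λ b<a → ≤⇒≯ ca≤cb (*-monoʳ-<-pos c 0<c b<a)

  square-nonNeg : ∀ x → 0ℝ ≤ x * x
  square-nonNeg x with compare 0ℝ x
  ... | tri< 0<x _ _  = inj₁ (*-pos 0<x 0<x)
  ... | tri≈ _ refl _ = inj₂ (sym (zeroˡ 0ℝ))
  ... | tri> _ _ x<0  = inj₁ (subst (0ℝ <_) (solve 1 (λ x → (con (pos 0) :- x) :* (con (pos 0) :- x) := x :* x) refl x)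
                                 (*-pos (x<y⇒0<y-x x<0) (x<y⇒0<y-x x<0)))

  square-nonPos⇒nonPos : ∀ {y} → y * y ≤ 0ℝ → y ≤ 0ℝ
  square-nonPos⇒nonPos yy≤0 = ≮⇒≥ λ 0<y → ≤⇒≯ yy≤0 (*-pos 0<y 0<y)

  0<1 : 0ℝ < 1ℝ
  0<1 with square-nonNeg 1ℝ
  ... | inj₁ 0<1*1 = subst (0ℝ <_) (*-identityˡ 1ℝ) 0<1*1
  ... | inj₂ 0≡1*1 = ⊥-elim (0≢1 (trans 0≡1*1 (*-identityˡ 1ℝ)))

  pos⇒≢0 : ∀ {x} → 0ℝ < x → x ≢ 0ℝ
  pos⇒≢0 0<x refl = <-irrefl 0<x

  *-cancelˡ-nonNeg : ∀ {c d} → 0ℝ < c → 0ℝ ≤ c * d → 0ℝ ≤ d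
  *-cancelˡ-nonNeg {c} 0<c 0≤cd = *-cancelˡ-≤-pos c 0<c (subst (_≤ _) (sym (zeroʳ c)) 0≤cd)

  ⁻¹-pos : ∀ {x} → 0ℝ < x → 0ℝ < x ⁻¹
  ⁻¹-pos {x} 0<x with compare 0ℝ (x ⁻¹)
  ... | tri< 0<x⁻¹ _ _ = 0<x⁻¹
  ... | tri≈ _ 0≡x⁻¹ _ =
    ⊥-elim (0≢1 (trans (trans (sym (zeroʳ x)) (cong (x *_) 0≡x⁻¹)) (⁻¹-inverse x (pos⇒≢0 0<x))))
  ... | tri> _ _ x⁻¹<0 =
    ⊥-elim (≤⇒≯ (inj₁ 0<1) (0<y-x⇒x<y (subst (0ℝ <_) eq (*-pos 0<x (x<y⇒0<y-x x⁻¹<0)))))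
    where
    eq : x * (0ℝ - x ⁻¹) ≡ 0ℝ - 1ℝ
    eq = trans (solve 2 (λ x y → x :* (con (pos 0) :- y) := con (pos 0) :- x :* y) refl x (x ⁻¹))
               (cong (λ z → 0ℝ - z) (⁻¹-inverse x (pos⇒≢0 0<x)))

  fromℕ-nonNeg : ∀ m → 0ℝ ≤ fromℕ m
  fromℕ-nonNeg zero    = ≤-refl
  fromℕ-nonNeg (suc m) = +-nonNeg (inj₁ 0<1) (fromℕ-nonNeg m)

  fromℕ-<-suc : ∀ m → fromℕ m < fromℕ (suc m)
  fromℕ-<-suc m = subst₂ _<_ (+-identityˡ _) refl (+-monoˡ-< (fromℕ m) 0<1)

  fromℕ-pos : ∀ m → 0ℝ < fromℕ (suc m)
  fromℕ-pos m = ≤-<-trans (fromℕ-nonNeg m) (fromℕ-<-suc m)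

  Fin⇒0<fromℕ : ∀ {m} → Fin m → 0ℝ < fromℕ m
  Fin⇒0<fromℕ {suc m} _ = fromℕ-pos m

  fromℕ-mono-≤ : ∀ {m n} → m ℕ.≤ n → fromℕ m ≤ fromℕ n
  fromℕ-mono-≤ {m} m≤n with ℕ.m≤n⇒∃[o]m+o≡n m≤n
  ... | d , refl = ≤-viaDifference (fromℕ d)
    (trans (cong (_- fromℕ m) (fromℕ-+ m d)) (solve 2 (λ a b → a :+ b :- a := b) refl (fromℕ m) (fromℕ d)))
    (fromℕ-nonNeg d)

  fromℕ-cancel-≤ : ∀ {m n} → fromℕ m ≤ fromℕ n → m ℕ.≤ n
  fromℕ-cancel-≤ {m} {n} fm≤fn with m ℕ.≤? n
  ... | yes m≤n = m≤n
  ... | no m≰n  = ⊥-elim (≤⇒≯ fm≤fn (<-≤-trans (fromℕ-<-suc n) (fromℕ-mono-≤ (ℕ.≰⇒> m≰n))))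

module SubsetLookup where
  open import Data.Bool using (Bool; true; false; _∧_; _∨_; not)
  import Data.Bool.Properties as Bool
  import Data.Nat as ℕ
  open import Data.Fin using (Fin; zero; suc)
  open import Data.Fin.Subset using (Subset; _∈_; _⊆_; _─_; _∪_; _∩_; ∁; ⁅_⁆; ⊥)
  open import Data.Fin.Properties using (_≟_)
  open import Data.Fin.Subset.Properties using (x∈⁅x⁆; x∈⁅y⁆⇒x≡y; x∈p∪q⁺; x∈p∪q⁻)
  import Data.Sum as Sum
  open import Data.Vec using (lookup; _∷_)
  import Data.Vec.Properties as Vec
  open import Data.Product using (∃; _×_; _,_)
  open import Data.Empty using (⊥-elim)
  open import Function using (_∘_)
  open import Relation.Nullary using (yes; no)
  open import Relation.Binary.PropositionalEquality

  true≢false : true ≢ false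
  true≢false ()

  not≡true⇒ : ∀ {b} → not b ≡ true → b ≡ false
  not≡true⇒ {false} _ = refl

  ∧≡true⇒ˡ : ∀ {a b} → a ∧ b ≡ true → a ≡ true
  ∧≡true⇒ˡ {true} _ = refl

  ∧≡true⇒ʳ : ∀ {a b} → a ∧ b ≡ true → b ≡ true
  ∧≡true⇒ʳ {true} {true} _ = refl

  infixl 9 _!_
  _!_ : ∀ {n} → Subset n → Fin n → Bool
  p ! i = lookup p i

  subset-ext : ∀ {n} {p q : Subset n} → (∀ i → p ! i ≡ q ! i) → p ≡ q
  subset-ext {p = p} {q} p≗q =
    trans (sym (Vec.tabulate∘lookup p)) (trans (Vec.tabulate-cong p≗q) (Vec.tabulate∘lookup q))

  ∈⇒lookup : ∀ {n} {p : Subset n} {i} → i ∈ p → p ! i ≡ true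
  ∈⇒lookup = Vec.[]=⇒lookup

  lookup⇒∈ : ∀ {n} {p : Subset n} {i} → p ! i ≡ true → i ∈ p
  lookup⇒∈ {p = p} {i} = Vec.lookup⇒[]= i p

  ⊆⇒lookup : ∀ {n} {p q : Subset n} → p ⊆ q → ∀ {i} → p ! i ≡ true → q ! i ≡ true
  ⊆⇒lookup p⊆q i∈p = ∈⇒lookup (p⊆q (lookup⇒∈ i∈p))

  lookup⇒⊆ : ∀ {n} {p q : Subset n} → (∀ i → p ! i ≡ true → q ! i ≡ true) → p ⊆ q
  lookup⇒⊆ p⊆q {i} i∈p = lookup⇒∈ (p⊆q i (∈⇒lookup i∈p))

  ∪-mono-⊆ : ∀ {n} {p p' q q' : Subset n} → p ⊆ p' → q ⊆ q' → p ∪ q ⊆ p' ∪ q'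
  ∪-mono-⊆ {p = p} {q = q} p⊆p' q⊆q' x∈p∪q = x∈p∪q⁺ (Sum.map p⊆p' q⊆q' (x∈p∪q⁻ p q x∈p∪q))

  lookup-∪ : ∀ {n} (p q : Subset n) i → (p ∪ q) ! i ≡ p ! i ∨ q ! i
  lookup-∪ p q i = Vec.lookup-zipWith _ i p q

  lookup-∩ : ∀ {n} (p q : Subset n) i → (p ∩ q) ! i ≡ p ! i ∧ q ! i
  lookup-∩ p q i = Vec.lookup-zipWith _ i p q

  lookup-─ : ∀ {n} (p q : Subset n) i → (p ─ q) ! i ≡ p ! i ∧ not (q ! i)
  lookup-─ (x ∷ p) (true  ∷ q) zero    = sym (Bool.∧-zeroʳ x)
  lookup-─ (x ∷ p) (false ∷ q) zero    = sym (Bool.∧-identityʳ x)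
  lookup-─ (x ∷ p) (_     ∷ q) (suc i) = lookup-─ p q i

  lookup-∁ : ∀ {n} (p : Subset n) i → ∁ p ! i ≡ not (p ! i)
  lookup-∁ (x ∷ p) zero    = refl
  lookup-∁ (x ∷ p) (suc i) = lookup-∁ p i

  lookup-⊥ : ∀ {n} i → ⊥ {n} ! i ≡ false
  lookup-⊥ i = Vec.lookup-replicate i false

  lookup-⁅x⁆-x : ∀ {n} (x : Fin n) → ⁅ x ⁆ ! x ≡ true
  lookup-⁅x⁆-x x = ∈⇒lookup (x∈⁅x⁆ x)

  lookup-⁅y⁆⇒≡ : ∀ {n} {x} (y : Fin n) → ⁅ y ⁆ ! x ≡ true → x ≡ y
  lookup-⁅y⁆⇒≡ y = x∈⁅y⁆⇒x≡y y ∘ lookup⇒∈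

  lookup-⁅y⁆-≢ : ∀ {n} {x} (y : Fin n) → x ≢ y → ⁅ y ⁆ ! x ≡ false
  lookup-⁅y⁆-≢ {x = x} y x≢y with ⁅ y ⁆ ! x in eq
  ... | false = refl
  ... | true  = ⊥-elim (x≢y (lookup-⁅y⁆⇒≡ y eq))

  p─⁅x⁆∪⁅x⁆≡p : ∀ {n} (p : Subset n) {x} → p ! x ≡ true → (p ─ ⁅ x ⁆) ∪ ⁅ x ⁆ ≡ p
  p─⁅x⁆∪⁅x⁆≡p p {x} x∈p = subset-ext λ i →
    trans (lookup-∪ (p ─ ⁅ x ⁆) ⁅ x ⁆ i) (trans (cong (_∨ ⁅ x ⁆ ! i) (lookup-─ p ⁅ x ⁆ i)) (pointwise i))
    where
    pointwise : ∀ i → (p ! i ∧ not (⁅ x ⁆ ! i)) ∨ ⁅ x ⁆ ! i ≡ p ! i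
    pointwise i with i ≟ x
    ... | yes refl rewrite lookup-⁅x⁆-x i | x∈p = refl
    ... | no i≢x rewrite lookup-⁅y⁆-≢ x i≢x | Bool.∧-identityʳ (p ! i) = Bool.∨-identityʳ _

  lookup-─⇒ : ∀ {n} (p q : Subset n) {i} → (p ─ q) ! i ≡ true → p ! i ≡ true × q ! i ≡ false
  lookup-─⇒ p q {i} i∈p─q with p ! i | q ! i | trans (sym (lookup-─ p q i)) i∈p─q
  ... | true | false | _ = refl , refl

  lookup-─⁅x⁆⇒ : ∀ {n} (p : Subset n) {x i} → (p ─ ⁅ x ⁆) ! i ≡ true → p ! i ≡ true × i ≢ x
  lookup-─⁅x⁆⇒ p {x} {i} i∈p─x with lookup-─⇒ p ⁅ x ⁆ i∈p─x
  ... | i∈p , i∉x = i∈p , λ { refl → true≢false (trans (sym (lookup-⁅x⁆-x i)) i∉x) }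

  lookup-─⁅x⁆⇐ : ∀ {n} (p : Subset n) {x i} → p ! i ≡ true → i ≢ x → (p ─ ⁅ x ⁆) ! i ≡ true
  lookup-─⁅x⁆⇐ p {x} {i} i∈p i≢x
    rewrite lookup-─ p ⁅ x ⁆ i | lookup-⁅y⁆-≢ x i≢x | i∈p = refl

  anyFin⇒∃ : ∀ {n} (g : Fin n → Bool) → anyFin g ≡ true → ∃ λ e → g e ≡ true
  anyFin⇒∃ {ℕ.suc n} g any with g zero in g0
  ... | true  = zero , g0
  ... | false = let e , ge = anyFin⇒∃ (g ∘ suc) any in suc e , ge

  lookup-⋃ : ∀ {n} (C : Subset n) (Y : Fin n → Subset n) {t} →
             (⋃[ C ] Y) ! t ≡ true → ∃ λ e → C ! e ≡ true × Y e ! t ≡ true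
  lookup-⋃ C Y {t} t∈⋃ with anyFin⇒∃ _ (trans (sym (Vec.lookup∘tabulate _ t)) t∈⋃)
  ... | e , w = e , ∧≡true⇒ˡ w , ∧≡true⇒ʳ {C ! e} w

module FiniteSums (ℝ : RealField) where
  open RealField ℝ
  open OrderedFieldProperties ℝ
  open SubsetLookup
  open import Data.Bool using (Bool; true; false; _∧_; if_then_else_)
  open import Data.Nat using (ℕ; zero; suc)
  open import Data.Fin using (Fin; zero; suc)
  open import Data.Fin.Properties using (_≟_; suc-injective)
  open import Data.Fin.Subset using (Subset; _─_; ⁅_⁆; ∣_∣)
  open import Data.Vec using (_∷_; [])
  open import Function using (_∘_)
  open import Relation.Nullary using (yes; no)
  open import Relation.Binary.PropositionalEquality

  when : Bool → R → R
  when b r = if b then r else 0ℝ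

  ∑ : ∀ {m} → (Fin m → R) → R
  ∑ {zero}  g = 0ℝ
  ∑ {suc m} g = g zero + ∑ (g ∘ suc)

  ∑[_]_ : ∀ {n} → Subset n → (Fin n → R) → R
  ∑[ X ] g = ∑ λ x → when (X ! x) (g x)

  when-nonNeg : ∀ b {r} → 0ℝ ≤ r → 0ℝ ≤ when b r
  when-nonNeg true  0≤r = 0≤r
  when-nonNeg false _   = ≤-refl

  when-≤ : ∀ b {r} → 0ℝ ≤ r → when b r ≤ r
  when-≤ true  _   = ≤-refl
  when-≤ false 0≤r = 0≤r

  when-mono-⇒ : ∀ b {r s} → (b ≡ true → r ≤ s) → when b r ≤ when b s
  when-mono-⇒ true  r≤s = r≤s refl
  when-mono-⇒ false _   = ≤-refl

  when-0 : ∀ b → when b 0ℝ ≡ 0ℝ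
  when-0 true  = refl
  when-0 false = refl

  when-∧ : ∀ a b r → when (a ∧ b) r ≡ when a (when b r)
  when-∧ true  b r = refl
  when-∧ false b r = refl

  when-+ : ∀ b r s → when b (r + s) ≡ when b r + when b s
  when-+ true  r s = refl
  when-+ false r s = sym (+-identityˡ 0ℝ)

  when-* : ∀ b c r → when b (c * r) ≡ c * when b r
  when-* true  c r = refl
  when-* false c r = sym (zeroʳ c)

  when-1 : ∀ b r → when b r ≡ when b 1ℝ * r
  when-1 true  r = sym (*-identityˡ r)
  when-1 false r = sym (zeroˡ r)

  ∑-cong : ∀ {m} {g h : Fin m → R} → (∀ i → g i ≡ h i) → ∑ g ≡ ∑ h
  ∑-cong {zero}  _   = refl
  ∑-cong {suc m} g≗h = cong₂ _+_ (g≗h zero) (∑-cong (g≗h ∘ suc))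

  ∑-mono : ∀ {m} {g h : Fin m → R} → (∀ i → g i ≤ h i) → ∑ g ≤ ∑ h
  ∑-mono {zero}  _   = ≤-refl
  ∑-mono {suc m} g≤h = +-mono-≤ (g≤h zero) (∑-mono (g≤h ∘ suc))

  ∑-≡0 : ∀ {m} {g : Fin m → R} → (∀ i → g i ≡ 0ℝ) → ∑ g ≡ 0ℝ
  ∑-≡0 {zero}  _    = refl
  ∑-≡0 {suc m} g≗0 = trans (cong₂ _+_ (g≗0 zero) (∑-≡0 (g≗0 ∘ suc))) (+-identityˡ 0ℝ)

  ∑-nonNeg : ∀ {m} {g : Fin m → R} → (∀ i → 0ℝ ≤ g i) → 0ℝ ≤ ∑ g
  ∑-nonNeg {zero}  _     = ≤-refl
  ∑-nonNeg {suc m} 0≤g = +-nonNeg (0≤g zero) (∑-nonNeg (0≤g ∘ suc))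

  ∑-+ : ∀ {m} (g h : Fin m → R) → ∑ (λ i → g i + h i) ≡ ∑ g + ∑ h
  ∑-+ {zero}  g h = sym (+-identityˡ 0ℝ)
  ∑-+ {suc m} g h = trans (cong ((g zero + h zero) +_) (∑-+ (g ∘ suc) (h ∘ suc)))
    (solve 4 (λ a b c d → (a :+ b) :+ (c :+ d) := (a :+ c) :+ (b :+ d)) refl
       (g zero) (h zero) (∑ (g ∘ suc)) (∑ (h ∘ suc)))

  ∑-distribˡ : ∀ {m} c (g : Fin m → R) → ∑ (λ i → c * g i) ≡ c * ∑ g
  ∑-distribˡ {zero}  c g = sym (zeroʳ c)
  ∑-distribˡ {suc m} c g = trans (cong ((c * g zero) +_) (∑-distribˡ c (g ∘ suc))) (sym (distribˡ c _ _))

  ∑-comm : ∀ {m m'} (g : Fin m → Fin m' → R) → ∑ (λ i → ∑ (g i)) ≡ ∑ (λ j → ∑ (λ i → g i j))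
  ∑-comm {zero}  {m'} g = sym (∑-≡0 {m'} (λ _ → refl))
  ∑-comm {suc m}      g = trans (cong (∑ (g zero) +_) (∑-comm (g ∘ suc)))
                                (sym (∑-+ (g zero) (λ j → ∑ (λ i → g (suc i) j))))

  ∑-single : ∀ {m} {g : Fin m → R} (u : Fin m) → (∀ i → i ≢ u → g i ≡ 0ℝ) → ∑ g ≡ g u
  ∑-single {suc m} zero    g≗0 = trans (cong (_ +_) (∑-≡0 (λ i → g≗0 (suc i) (λ ())))) (+-identityʳ _)
  ∑-single {suc m} (suc u) g≗0 =
    trans (cong₂ _+_ (g≗0 zero (λ ())) (∑-single u (λ i i≢u → g≗0 (suc i) (i≢u ∘ suc-injective))))
          (+-identityˡ _)

  term≤∑ : ∀ {m} {g : Fin m → R} (u : Fin m) → (∀ i → 0ℝ ≤ g i) → g u ≤ ∑ g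
  term≤∑ {suc m} {g} zero    0≤g =
    subst (_≤ g zero + ∑ (g ∘ suc)) (+-identityʳ _) (+-monoʳ-≤ (g zero) (∑-nonNeg (0≤g ∘ suc)))
  term≤∑ {suc m} {g} (suc u) 0≤g =
    ≤-trans (term≤∑ u (0≤g ∘ suc)) (subst (_≤ g zero + ∑ (g ∘ suc)) (+-identityˡ _) (+-monoˡ-≤ _ (0≤g zero)))

  ∑-const : ∀ {m} c → ∑ {m} (λ _ → c) ≡ fromℕ m * c
  ∑-const {zero}  c = sym (zeroˡ c)
  ∑-const {suc m} c = trans (cong (c +_) (∑-const {m} c))
    (sym (trans (distribʳ c 1ℝ (fromℕ m)) (cong (_+ fromℕ m * c) (*-identityˡ c))))

  when-∑ : ∀ {m} b (g : Fin m → R) → when b (∑ g) ≡ ∑ (λ i → when b (g i))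
  when-∑         true  g = refl
  when-∑ {m}     false g = sym (∑-≡0 {m} (λ _ → refl))

  module _ {n : ℕ} where

    fromℕ-∣p∣≡∑[p]1 : (p : Subset n) → fromℕ ∣ p ∣ ≡ ∑[ p ] (λ _ → 1ℝ)
    fromℕ-∣p∣≡∑[p]1 = go
      where
      go : ∀ {m} (p : Subset m) → fromℕ ∣ p ∣ ≡ ∑[ p ] (λ _ → 1ℝ)
      go []          = refl
      go (true ∷ p)  = cong (1ℝ +_) (go p)
      go (false ∷ p) = trans (go p) (sym (+-identityˡ _))

    ∑[]-cong : ∀ (P : Subset n) {g h} → (∀ o → P ! o ≡ true → g o ≡ h o) → ∑[ P ] g ≡ ∑[ P ] h
    ∑[]-cong P {g} {h} g≗h = ∑-cong pointwise
      where
      pointwise : ∀ o → when (P ! o) (g o) ≡ when (P ! o) (h o)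
      pointwise o with P ! o in o∈P
      ... | true  = g≗h o o∈P
      ... | false = refl

    ∑[]-mono : ∀ (P : Subset n) {g h} → (∀ o → P ! o ≡ true → g o ≤ h o) → ∑[ P ] g ≤ ∑[ P ] h
    ∑[]-mono P {g} {h} g≤h = ∑-mono pointwise
      where
      pointwise : ∀ o → when (P ! o) (g o) ≤ when (P ! o) (h o)
      pointwise o with P ! o in o∈P
      ... | true  = g≤h o o∈P
      ... | false = ≤-refl

    ∑[]-nonNeg : ∀ (P : Subset n) {g} → (∀ o → P ! o ≡ true → 0ℝ ≤ g o) → 0ℝ ≤ ∑[ P ] g
    ∑[]-nonNeg P {g} 0≤g = subst (_≤ ∑[ P ] g) (∑-≡0 (λ o → when-0 (P ! o))) (∑[]-mono P {λ _ → 0ℝ} 0≤g)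

    ∑[]-empty : ∀ (P : Subset n) g → (∀ o → P ! o ≡ false) → ∑[ P ] g ≡ 0ℝ
    ∑[]-empty P g P≗∅ = ∑-≡0 (λ o → cong (λ b → when b (g o)) (P≗∅ o))

    ∑[]-+ : ∀ (P : Subset n) g h → ∑[ P ] (λ o → g o + h o) ≡ ∑[ P ] g + ∑[ P ] h
    ∑[]-+ P g h = trans (∑-cong (λ o → when-+ (P ! o) (g o) (h o))) (∑-+ {n} _ _)

    ∑[]-distribˡ : ∀ (P : Subset n) c g → ∑[ P ] (λ o → c * g o) ≡ c * ∑[ P ] g
    ∑[]-distribˡ P c g = trans (∑-cong (λ o → when-* (P ! o) c (g o))) (∑-distribˡ {n} c _)

    ∑[⁅u⁆] : ∀ (g : Fin n → R) u → ∑[ ⁅ u ⁆ ] g ≡ g u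
    ∑[⁅u⁆] g u = trans (∑-single u (λ i i≢u → cong (λ b → when b (g i)) (lookup-⁅y⁆-≢ u i≢u)))
                       (cong (λ b → when b (g u)) (lookup-⁅x⁆-x u))

    ∑[]-split : ∀ (T : Subset n) (g : Fin n → R) u → T ! u ≡ true →
                ∑[ T ] g ≡ ∑[ T ─ ⁅ u ⁆ ] g + g u
    ∑[]-split T g u u∈T =
      trans (∑-cong pointwise) (trans (∑-+ {n} _ _) (cong (∑[ T ─ ⁅ u ⁆ ] g +_) (∑[⁅u⁆] g u)))
      where
      pointwise : ∀ i → when (T ! i) (g i) ≡ when ((T ─ ⁅ u ⁆) ! i) (g i) + when (⁅ u ⁆ ! i) (g i)
      pointwise i rewrite lookup-─ T ⁅ u ⁆ i with i ≟ u
      ... | yes refl rewrite u∈T | lookup-⁅x⁆-x u = sym (+-identityˡ _)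
      ... | no i≢u rewrite lookup-⁅y⁆-≢ u i≢u with T ! i
      ...   | true  = sym (+-identityʳ _)
      ...   | false = sym (+-identityʳ _)

module Telescoping (ℝ : RealField) where
  open RealField ℝ
  open OrderedFieldProperties ℝ
  open FiniteSums ℝ
  open SubsetLookup
  open import Data.Bool using (true; false; _∧_; not; T)
  import Data.Bool.Properties as Bool
  open import Data.Unit using (tt)
  open import Data.Nat as ℕ using (ℕ; zero; suc; _<ᵇ_; _⊔_)
  import Data.Nat.Properties as ℕ
  open import Data.Fin using (Fin)
  open import Data.Fin.Properties using (_≟_; any?)
  open import Data.Fin.Subset using (Subset; _⊆_; _─_; _∪_; ⁅_⁆; ⊥)
  open import Data.Vec using (tabulate)
  import Data.Vec.Properties as Vec
  open import Data.Product using (Σ; _,_)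
  open import Data.Empty using (⊥-elim)
  open import Function using (_∘_)
  open import Function.Definitions using (Injective)
  open import Relation.Nullary using (yes; no; ¬_)
  open import Relation.Nullary.Decidable using (_×-dec_)
  open import Relation.Binary.PropositionalEquality

  <⇒<ᵇ≡true : ∀ {m n} → m ℕ.< n → (m <ᵇ n) ≡ true
  <⇒<ᵇ≡true {m} {n} m<n with m <ᵇ n | ℕ.<⇒<ᵇ m<n
  ... | true | _ = refl

  ≮⇒<ᵇ≡false : ∀ {m n} → ¬ (m ℕ.< n) → (m <ᵇ n) ≡ false
  ≮⇒<ᵇ≡false {m} {n} m≮n with m <ᵇ n in eq
  ... | false = refl
  ... | true  = ⊥-elim (m≮n (ℕ.<ᵇ⇒< m n (subst T (sym eq) tt)))

  maxOf : ∀ {m} → (Fin m → ℕ) → ℕ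
  maxOf {zero}  g = 0
  maxOf {suc m} g = g Fin.zero ⊔ maxOf (g ∘ Fin.suc)

  ≤-maxOf : ∀ {m} (g : Fin m → ℕ) i → g i ℕ.≤ maxOf g
  ≤-maxOf g Fin.zero    = ℕ.m≤m⊔n _ _
  ≤-maxOf g (Fin.suc i) = ℕ.≤-trans (≤-maxOf (g ∘ Fin.suc) i) (ℕ.m≤n⊔m _ _)

  module _ {n} (rank : Fin n → ℕ) where

    before : Subset n → Fin n → Subset n
    before X s = tabulate λ t → X ! t ∧ (rank t <ᵇ rank s)

    before-mono : ∀ {X X'} s → X ⊆ X' → before X s ⊆ before X' s
    before-mono {X} {X'} s X⊆X' = lookup⇒⊆ λ t t∈before → trans (Vec.lookup∘tabulate _ t)
      (pointwise (trans (sym (Vec.lookup∘tabulate _ t)) t∈before))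
      where
      pointwise : ∀ {t} → X ! t ∧ (rank t <ᵇ rank s) ≡ true → X' ! t ∧ (rank t <ᵇ rank s) ≡ true
      pointwise {t} both rewrite ∈⇒lookup (X⊆X' (lookup⇒∈ (∧≡true⇒ˡ both))) = ∧≡true⇒ʳ {X ! t} both

    s∉before : ∀ X s → before X s ! s ≡ false
    s∉before X s = trans (Vec.lookup∘tabulate _ s)
      (trans (cong (X ! s ∧_) (≮⇒<ᵇ≡false (ℕ.n≮n (rank s)))) (Bool.∧-zeroʳ _))

  module _ {n} (rank : Fin n → ℕ) (rank-injective : Injective _≡_ _≡_ rank) (h : Subset n → R) where

    gain : Subset n → Fin n → R
    gain X t = h (before rank X t ∪ ⁅ t ⁆) - h (before rank X t)

    module _ {T : Subset n} {u} (u∈T : T ! u ≡ true) (top : ∀ t → T ! t ≡ true → rank t ℕ.≤ rank u) where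

      private
        below-top : ∀ {t} → T ! t ≡ true → t ≢ u → rank t ℕ.< rank u
        below-top t∈T t≢u = ℕ.≤∧≢⇒< (top _ t∈T) (t≢u ∘ rank-injective)

        lookup-T─u : ∀ t → (T ─ ⁅ u ⁆) ! t ≡ T ! t ∧ not (⁅ u ⁆ ! t)
        lookup-T─u t = lookup-─ T ⁅ u ⁆ t

      before-top : before rank T u ≡ T ─ ⁅ u ⁆
      before-top = subset-ext λ t → trans (Vec.lookup∘tabulate _ t) (trans (pointwise t) (sym (lookup-T─u t)))
        where
        pointwise : ∀ t → T ! t ∧ (rank t <ᵇ rank u) ≡ T ! t ∧ not (⁅ u ⁆ ! t)
        pointwise t with t ≟ u
        ... | yes refl rewrite lookup-⁅x⁆-x t | ≮⇒<ᵇ≡false (ℕ.n≮n (rank t)) = refl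
        ... | no t≢u rewrite lookup-⁅y⁆-≢ u t≢u | Bool.∧-identityʳ (T ! t) with T ! t in t∈T
        ...   | false = refl
        ...   | true  = <⇒<ᵇ≡true (below-top t∈T t≢u)

      before-below-top : ∀ i → (T ─ ⁅ u ⁆) ! i ≡ true → before rank T i ≡ before rank (T ─ ⁅ u ⁆) i
      before-below-top i i∈T─u = subset-ext λ t →
        trans (Vec.lookup∘tabulate _ t) (trans (pointwise t) (sym (Vec.lookup∘tabulate _ t)))
        where
        open Σ (lookup-─⁅x⁆⇒ T i∈T─u) renaming (proj₁ to i∈T; proj₂ to i≢u)
        pointwise : ∀ t → T ! t ∧ (rank t <ᵇ rank i) ≡ (T ─ ⁅ u ⁆) ! t ∧ (rank t <ᵇ rank i)
        pointwise t rewrite lookup-T─u t with t ≟ u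
        ... | yes refl rewrite lookup-⁅x⁆-x t
                             | ≮⇒<ᵇ≡false (ℕ.<-asym (below-top i∈T i≢u)) = trans (Bool.∧-zeroʳ _) (sym (Bool.∧-zeroʳ _))
        ... | no t≢u rewrite lookup-⁅y⁆-≢ u t≢u | Bool.∧-identityʳ (T ! t) = refl

      ∑-gain-remove-top : ∑[ T ] (gain T) ≡ ∑[ T ─ ⁅ u ⁆ ] (gain (T ─ ⁅ u ⁆)) + (h T - h (T ─ ⁅ u ⁆))
      ∑-gain-remove-top = begin
        ∑[ T ] (gain T)                                    ≡⟨ ∑[]-split T (gain T) u u∈T ⟩
        ∑[ T ─ ⁅ u ⁆ ] (gain T) + gain T u                 ≡⟨ cong₂ _+_ (∑[]-cong (T ─ ⁅ u ⁆) gain-below) gain-top ⟩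
        ∑[ T ─ ⁅ u ⁆ ] (gain (T ─ ⁅ u ⁆)) + (h T - h (T ─ ⁅ u ⁆)) ∎
        where
        open ≡-Reasoning
        gain-below : ∀ i → (T ─ ⁅ u ⁆) ! i ≡ true → gain T i ≡ gain (T ─ ⁅ u ⁆) i
        gain-below i i∈T─u = cong (λ X → h (X ∪ ⁅ i ⁆) - h X) (before-below-top i i∈T─u)
        gain-top : gain T u ≡ h T - h (T ─ ⁅ u ⁆)
        gain-top rewrite before-top = cong (λ X → h X - h (T ─ ⁅ u ⁆)) (p─⁅x⁆∪⁅x⁆≡p T u∈T)

    ∑-gain-bounded : ∀ b T → (∀ t → T ! t ≡ true → rank t ℕ.< b) → ∑[ T ] (gain T) ≡ h T - h ⊥
    ∑-gain-bounded zero T bound = begin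
      ∑[ T ] (gain T) ≡⟨ ∑[]-empty T (gain T) T-empty ⟩
      0ℝ              ≡⟨ sym (-‿inverseʳ (h ⊥)) ⟩
      h ⊥ - h ⊥       ≡⟨ cong (λ X → h X - h ⊥) (sym T≡⊥) ⟩
      h T - h ⊥       ∎
      where
      open ≡-Reasoning
      T-empty : ∀ t → T ! t ≡ false
      T-empty t with T ! t in t∈T
      ... | false = refl
      ... | true  = ⊥-elim (ℕ.n≮0 (bound t t∈T))
      T≡⊥ : T ≡ ⊥
      T≡⊥ = subset-ext λ t → trans (T-empty t) (sym (lookup-⊥ t))
    ∑-gain-bounded (suc b) T bound with any? (λ u → (T ! u Bool.≟ true) ×-dec (rank u ℕ.≟ b))
    ... | no none = ∑-gain-bounded b T λ t t∈T → ℕ.≤∧≢⇒< (ℕ.m<1+n⇒m≤n (bound t t∈T)) (λ r → none (t , t∈T , r))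
    ... | yes (u , u∈T , ru≡b) = begin
      ∑[ T ] (gain T)                                        ≡⟨ ∑-gain-remove-top u∈T top ⟩
      ∑[ T ─ ⁅ u ⁆ ] (gain (T ─ ⁅ u ⁆)) + (h T - h (T ─ ⁅ u ⁆)) ≡⟨ cong (_+ _) (∑-gain-bounded b (T ─ ⁅ u ⁆) bound') ⟩
      (h (T ─ ⁅ u ⁆) - h ⊥) + (h T - h (T ─ ⁅ u ⁆))          ≡⟨ solve 3 (λ a b c → (a :- b) :+ (c :- a) := c :- b) refl _ _ _ ⟩
      h T - h ⊥                                              ∎
      where
      open ≡-Reasoning
      top : ∀ t → T ! t ≡ true → rank t ℕ.≤ rank u
      top t t∈T = subst (rank t ℕ.≤_) (sym ru≡b) (ℕ.m<1+n⇒m≤n (bound t t∈T))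
      bound' : ∀ t → (T ─ ⁅ u ⁆) ! t ≡ true → rank t ℕ.< b
      bound' t t∈T─u = let t∈T , t≢u = lookup-─⁅x⁆⇒ T t∈T─u in
        subst (rank t ℕ.<_) ru≡b (ℕ.≤∧≢⇒< (top t t∈T) (t≢u ∘ rank-injective))

    ∑-gain : ∀ T → ∑[ T ] (gain T) ≡ h T - h ⊥
    ∑-gain T = ∑-gain-bounded (suc (maxOf rank)) T (λ t _ → ℕ.s≤s (≤-maxOf rank t))

module Rounding (ℝ : RealField) where
  open RealField ℝ
  open OrderedFieldProperties ℝ
  open import Data.Integer using (-[1+_]) renaming (+_ to pos)
  open import Data.Sum using (inj₁; inj₂)
  open import Data.Empty using (⊥-elim)
  open import Relation.Binary.PropositionalEquality

  roundDown : R → R → R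
  roundDown α z = fromℤ ⌊ z / α ⌋ * α

  private
    z/α*α≡z : ∀ {α} z → 0ℝ < α → (z / α) * α ≡ z
    z/α*α≡z {α} z 0<α = trans (*-assoc _ _ _)
      (trans (cong (z *_) (trans (*-comm _ _) (⁻¹-inverse α (pos⇒≢0 0<α)))) (*-identityʳ z))

    ⌊⌋-nonNeg : ∀ y → 0ℝ ≤ y → 0ℝ ≤ fromℤ ⌊ y ⌋
    ⌊⌋-nonNeg y 0≤y with ⌊ y ⌋ | ⌊⌋-upper y
    ... | pos m    | _ = fromℕ-nonNeg m
    ... | -[1+ m ] | y<⌊y⌋+1 = ⊥-elim (≤⇒≯ 0≤y (<-≤-trans y<⌊y⌋+1 ⌊y⌋+1≤0))
      where
      ⌊y⌋+1≤0 : fromℤ -[1+ m ] + 1ℝ ≤ 0ℝ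
      ⌊y⌋+1≤0 = ≤-viaDifference (fromℕ m)
        (solve 2 (λ a one → con (pos 0) :- (:- (one :+ a) :+ one) := a) refl (fromℕ m) 1ℝ) (fromℕ-nonNeg m)

  roundDown-nonNeg : ∀ {α} z → 0ℝ ≤ α → 0ℝ ≤ z → 0ℝ ≤ roundDown α z
  roundDown-nonNeg     z (inj₁ 0<α) 0≤z = *-nonNeg (⌊⌋-nonNeg _ (*-nonNeg 0≤z (inj₁ (⁻¹-pos 0<α)))) (inj₁ 0<α)
  roundDown-nonNeg {α} z (inj₂ refl) _  = inj₂ (sym (zeroʳ _))

  roundDown≤z : ∀ {α} z → 0ℝ ≤ α → 0ℝ ≤ z → roundDown α z ≤ z
  roundDown≤z {α} z (inj₁ 0<α) _ =
    subst (roundDown α z ≤_) (z/α*α≡z z 0<α) (*-monoˡ-≤-nonNeg α (inj₁ 0<α) (⌊⌋-lower (z / α)))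
  roundDown≤z     z (inj₂ refl) 0≤z = subst (_≤ z) (sym (zeroʳ _)) 0≤z

  z-α≤roundDown : ∀ {α} z → 0ℝ < α → z - α ≤ roundDown α z
  z-α≤roundDown {α} z 0<α = inj₁ (<-viaDifference _ eq (*-pos (x<y⇒0<y-x (⌊⌋-upper (z / α))) 0<α))
    where
    eq : roundDown α z - (z - α) ≡ ((fromℤ ⌊ z / α ⌋ + 1ℝ) - z / α) * α
    eq = sym (trans (solve 4 (λ a b w α → ((a :+ b) :- w) :* α := a :* α :- (w :* α :- b :* α))
                               refl (fromℤ ⌊ z / α ⌋) 1ℝ (z / α) α)
                    (cong₂ (λ u v → roundDown α z - (u - v)) (z/α*α≡z z 0<α) (*-identityˡ α)))

module SquareTrick (ℝ : RealField) where
  open RealField ℝ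
  open OrderedFieldProperties ℝ
  open FiniteSums ℝ
  open SubsetLookup
  open import Data.Bool using (Bool; true; false)
  import Data.Nat as ℕ
  open import Data.Fin using (Fin; zero; suc)
  open import Data.Fin.Properties using (_≟_)
  open import Data.Fin.Subset using (Subset; _─_; ⁅_⁆)
  open import Data.Integer using () renaming (+_ to pos)
  open import Data.Sum using (_⊎_; inj₁; inj₂)
  open import Data.Product using (Σ; _×_; _,_)
  open import Data.Empty using (⊥-elim)
  open import Function using (_∘_)
  open import Relation.Nullary using (yes; no)
  open import Relation.Binary.Definitions using (tri<; tri≈; tri>)
  open import Relation.Binary.PropositionalEquality

  argmax : ∀ {m} (P : Fin m → Bool) (g : Fin m → R) →
    (∀ i → P i ≡ false) ⊎ Σ (Fin m) λ u → P u ≡ true × (∀ i → P i ≡ true → g i ≤ g u)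
  argmax {ℕ.zero}  P g = inj₁ λ ()
  argmax {ℕ.suc m} P g with argmax (P ∘ suc) (g ∘ suc) | P zero in P0
  ... | inj₁ none | false = inj₁ λ { zero → P0 ; (suc i) → none i }
  ... | inj₁ none | true  = inj₂ (zero , P0 , λ { zero _ → ≤-refl ; (suc i) Pi → ⊥-elim (true≢false (trans (sym Pi) (none i))) })
  ... | inj₂ (u , Pu , max) | false = inj₂ (suc u , Pu , λ { zero P0' → ⊥-elim (true≢false (trans (sym P0') P0)) ; (suc i) → max i })
  ... | inj₂ (u , Pu , max) | true with compare (g zero) (g (suc u))
  ...   | tri< g0<gu _ _ = inj₂ (suc u , Pu , λ { zero _ → inj₁ g0<gu ; (suc i) → max i })
  ...   | tri≈ _ g0≡gu _ = inj₂ (suc u , Pu , λ { zero _ → inj₂ g0≡gu ; (suc i) → max i })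
  ...   | tri> _ _ gu<g0 = inj₂ (zero , P0 , λ { zero _ → ≤-refl ; (suc i) Pi → inj₁ (≤-<-trans (max i Pi) gu<g0) })

  ∑[⋃]≤ : ∀ {n} (P : Subset n) (Z : Fin n → Subset n) (g : Fin n → R) s → (∀ t → 0ℝ ≤ g t) →
          ∑[ ⋃[ P ] Z ] g ≤ g s + ∑[ P ] (λ e → ∑[ Z e ─ ⁅ s ⁆ ] g)
  ∑[⋃]≤ {n} P Z g s 0≤g = begin
    ∑[ ⋃[ P ] Z ] g                                       ≤⟨ ∑-mono pointwise ⟩
    ∑ (λ t → when (⁅ s ⁆ ! t) (g t) + ∑ (cover t))         ≡⟨ ∑-+ {n} _ _ ⟩
    ∑[ ⁅ s ⁆ ] g + ∑ (λ t → ∑ (cover t))                   ≡⟨ cong₂ _+_ (∑[⁅u⁆] g s) (trans (∑-comm cover)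
                                                               (∑-cong (λ e → sym (when-∑ {n} (P ! e) _)))) ⟩
    g s + ∑[ P ] (λ e → ∑[ Z e ─ ⁅ s ⁆ ] g)                ∎
    where
    open ≤-Reasoning
    cover : Fin n → Fin n → R
    cover t e = when (P ! e) (when ((Z e ─ ⁅ s ⁆) ! t) (g t))
    0≤cover : ∀ t e → 0ℝ ≤ cover t e
    0≤cover t e = when-nonNeg (P ! e) (when-nonNeg _ (0≤g t))
    pointwise : ∀ t → when ((⋃[ P ] Z) ! t) (g t) ≤ when (⁅ s ⁆ ! t) (g t) + ∑ (cover t)
    pointwise t with t ≟ s | (⋃[ P ] Z) ! t in t∈⋃
    ... | yes refl | _ rewrite lookup-⁅x⁆-x t = ≤-trans (when-≤ _ (0≤g t)) (x≤x+y (∑-nonNeg (0≤cover t)))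
    ... | no t≢s | false rewrite lookup-⁅y⁆-≢ s t≢s = +-nonNeg ≤-refl (∑-nonNeg (0≤cover t))
    ... | no t≢s | true  rewrite lookup-⁅y⁆-≢ s t≢s | +-identityˡ (∑ (cover t)) with lookup-⋃ P Z t∈⋃
    ...   | e , e∈P , t∈Ze = subst (_≤ ∑ (cover t)) cover-e (term≤∑ e (0≤cover t))
      where
      cover-e : cover t e ≡ g t
      cover-e = trans (cong (λ b → when b _) e∈P) (cong (λ b → when b (g t)) (lookup-─⁅x⁆⇐ (Z e) t∈Ze t≢s))

  module _ {n} (P : Subset n) (Z : Fin n → Subset n) (x y : Fin n → R) (s : Fin n)
           (0≤x : ∀ t → 0ℝ ≤ x t) (s∈Z : ∀ o → P ! o ≡ true → Z o ! s ≡ true)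
           (s-max : ∀ o → P ! o ≡ true → ∀ t → Z o ! t ≡ true → x t ≤ x s)
           (squares≤ : ∑[ P ] (λ o → y o * y o) ≤ ∑[ ⋃[ P ] Z ] (λ t → x t * x t)) where

    private
      x≤x[s] : ∀ t → (⋃[ P ] Z) ! t ≡ true → x t ≤ x s
      x≤x[s] t t∈⋃ with lookup-⋃ P Z t∈⋃
      ... | o , o∈P , t∈Zo = s-max o o∈P t t∈Zo

      rhs-nonNeg : 0ℝ ≤ x s + ∑[ P ] (λ o → ∑[ Z o ] x)
      rhs-nonNeg = +-nonNeg (0≤x s) (∑[]-nonNeg P (λ o _ → ∑[]-nonNeg (Z o) (λ t _ → 0≤x t)))

    -- With c = x s: 2 c y ≤ y² + c² for each o ∈ P, and x t² ≤ c x t on the union since s is heaviest.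
    twice-∑≤-pos : 0ℝ < x s → ∑[ P ] y + ∑[ P ] y ≤ x s + ∑[ P ] (λ o → ∑[ Z o ] x)
    twice-∑≤-pos 0<c = *-cancelˡ-≤-pos c 0<c (begin
      c * (∑[ P ] y + ∑[ P ] y)                         ≡⟨ sym (trans (∑[]-+ P _ _) (trans (cong₂ _+_ (∑[]-distribˡ P c y)
                                                             (∑[]-distribˡ P c y)) (sym (distribˡ c _ _)))) ⟩
      ∑[ P ] (λ o → c * y o + c * y o)                  ≤⟨ ∑[]-mono P (λ o _ → am-gm (y o)) ⟩
      ∑[ P ] (λ o → y o * y o + c * c)                  ≡⟨ ∑[]-+ P _ _ ⟩
      ∑[ P ] (λ o → y o * y o) + ∑[ P ] (λ _ → c * c)   ≤⟨ +-monoˡ-≤ _ squares≤ ⟩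
      ∑[ U ] (λ t → x t * x t) + ∑[ P ] (λ _ → c * c)   ≤⟨ +-monoˡ-≤ _ (∑[]-mono U (λ t t∈U →
                                                             *-monoˡ-≤-nonNeg (x t) (0≤x t) (x≤x[s] t t∈U))) ⟩
      ∑[ U ] (λ t → c * x t) + ∑[ P ] (λ _ → c * c)     ≡⟨ cong₂ _+_ (∑[]-distribˡ U c x) (∑[]-distribˡ P c (λ _ → c)) ⟩
      c * ∑[ U ] x + c * ∑[ P ] (λ _ → c)               ≤⟨ +-monoˡ-≤ _ (*-monoʳ-≤-nonNeg c (inj₁ 0<c) (∑[⋃]≤ P Z x s 0≤x)) ⟩
      c * (c + ∑[ P ] (λ o → ∑[ Z o ─ ⁅ s ⁆ ] x)) + c * ∑[ P ] (λ _ → c)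
                                                        ≡⟨ solve 3 (λ c a b → c :* (c :+ a) :+ c :* b := c :* (c :+ (a :+ b))) refl c _ _ ⟩
      c * (c + (∑[ P ] (λ o → ∑[ Z o ─ ⁅ s ⁆ ] x) + ∑[ P ] (λ _ → c)))
                                                        ≡⟨ cong (λ z → c * (c + z)) (trans (sym (∑[]-+ P _ _))
                                                             (∑[]-cong P (λ o o∈P → sym (∑[]-split (Z o) x s (s∈Z o o∈P))))) ⟩
      c * (x s + ∑[ P ] (λ o → ∑[ Z o ] x))             ∎)
      where
      open ≤-Reasoning
      c : R
      c = x s
      U : Subset n
      U = ⋃[ P ] Z
      am-gm : ∀ a → c * a + c * a ≤ a * a + c * c
      am-gm a = ≤-viaDifference ((a - c) * (a - c))
        (solve 2 (λ a c → (a :* a :+ c :* c) :- (c :* a :+ c :* a) := (a :- c) :* (a :- c)) refl a c) (square-nonNeg _)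

    twice-∑≤-zero : x s ≡ 0ℝ → ∑[ P ] y + ∑[ P ] y ≤ x s + ∑[ P ] (λ o → ∑[ Z o ] x)
    twice-∑≤-zero c≡0 =
      ≤-trans (+-mono-≤ ∑y≤0 ∑y≤0) (subst (_≤ x s + ∑[ P ] (λ o → ∑[ Z o ] x)) (sym (+-identityˡ 0ℝ)) rhs-nonNeg)
      where
      ∑y²≤0 : ∑[ P ] (λ o → y o * y o) ≤ 0ℝ
      ∑y²≤0 = ≤-trans squares≤ (≤-reflexive (trans (∑[]-cong (⋃[ P ] Z) λ t t∈⋃ →
                trans (cong (λ z → z * z) (≤-antisym (subst (x t ≤_) c≡0 (x≤x[s] t t∈⋃)) (0≤x t))) (zeroˡ 0ℝ))
                (∑-≡0 {n} (λ t → when-0 _))))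
      y≤0 : ∀ o → P ! o ≡ true → y o ≤ 0ℝ
      y≤0 o o∈P = square-nonPos⇒nonPos (≤-trans
        (subst (_≤ ∑[ P ] (λ o → y o * y o)) (cong (λ b → when b (y o * y o)) o∈P)
               (term≤∑ o (λ i → when-nonNeg (P ! i) (square-nonNeg (y i))))) ∑y²≤0)
      ∑y≤0 : ∑[ P ] y ≤ 0ℝ
      ∑y≤0 = ≤-trans (∑[]-mono P y≤0) (≤-reflexive (∑-≡0 {n} (λ o → when-0 (P ! o))))

    twice-∑≤ : ∑[ P ] y + ∑[ P ] y ≤ x s + ∑[ P ] (λ o → ∑[ Z o ] x)
    twice-∑≤ with 0≤x s
    ... | inj₁ 0<x[s] = twice-∑≤-pos 0<x[s]
    ... | inj₂ 0≡x[s] = twice-∑≤-zero (sym 0≡x[s])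

module LocalSearch (ℝ : RealField) where
  open RealField ℝ
  open OrderedFieldProperties ℝ
  open FiniteSums ℝ
  open SubsetLookup
  open Telescoping ℝ
  open Rounding ℝ
  open SquareTrick ℝ
  module SF = SetFunctions ℝ
  open import Data.Bool using (Bool; true; false; _∧_; _∨_; not)
  import Data.Bool.Properties as Bool
  open import Data.Nat as ℕ using (ℕ; zero; suc)
  import Data.Nat.Properties as ℕ
  open import Data.Integer using () renaming (+_ to pos)
  open import Data.Fin using (Fin)
  open import Data.Fin.Properties using (_≟_; any?)
  open import Data.Fin.Subset using (Subset; _∈_; _⊆_; _─_; _∪_; _∩_; ∁; ⁅_⁆; ∣_∣; ⊥)
  open import Data.Fin.Subset.Properties
    using (p⊆q⇒∣p∣≤∣q∣; ∣⊥∣≡0; ∣⁅x⁆∣≡1; ∪-assoc; ∪-identityˡ; ∪-identityʳ; p⊆p∪q; p─q⊆p; ⊥⊆)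
  open import Data.Vec using (tabulate)
  import Data.Vec.Properties as Vec
  open import Data.Sum using (_⊎_; inj₁; inj₂)
  open import Data.Product using (Σ; _×_; _,_; proj₁; proj₂)
  open import Data.Empty using (⊥-elim)
  open import Function using (_∘_)
  open import Function.Definitions using (Injective)
  open import Relation.Nullary using (yes; no; does)
  open import Relation.Binary.PropositionalEquality
  open import Relation.Binary.Construct.Closure.ReflexiveTransitive as Star using (Star; _◅_)

  private
    module SlackAlgebra (K ε a b : R) (0<K : 0ℝ < K) (0<ε : 0ℝ < ε) where
      two q D δ h one : R
      two = fromℕ 2
      q = (two * ε) ⁻¹
      D = 1ℝ + K * q
      δ = D ⁻¹
      h = two ⁻¹
      one = fromℤ (pos 1)

      0<two : 0ℝ < two
      0<two = fromℕ-pos 1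

      0<D : 0ℝ < D
      0<D = +-pos-nonNeg 0<1 (inj₁ (*-pos 0<K (⁻¹-pos (*-pos 0<two 0<ε))))

      inverse : ∀ {x} → 0ℝ < x → x * x ⁻¹ ≡ one
      inverse {x} 0<x = trans (⁻¹-inverse x (pos⇒≢0 0<x)) (sym (+-identityʳ 1ℝ))

      εq≡h : ε * q ≡ h
      εq≡h = begin
        ε * q                       ≡⟨ solve 1 (λ z → z := con (pos 1) :* z) refl (ε * q) ⟩
        one * (ε * q)               ≡⟨ cong (_* (ε * q)) (sym (inverse 0<two)) ⟩
        (two * h) * (ε * q)         ≡⟨ solve 3 (λ h e q → (con (pos 2) :* h) :* (e :* q) := h :* ((con (pos 2) :* e) :* q)) refl h ε q ⟩
        h * ((two * ε) * q)         ≡⟨ cong (h *_) (inverse (*-pos 0<two 0<ε)) ⟩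
        h * one                     ≡⟨ solve 1 (λ z → z :* con (pos 1) := z) refl h ⟩
        h                           ∎
        where open ≡-Reasoning

      expand : R → R → R
      expand d z = (ε * d) * K * b - two * (ε * d) * a + two * ε * z * a

      collect : R → R
      collect w = ε * K * b + K * K * w * b - K * (two * w) * a

      scaled-slack : (ε * D) * (K * b + (δ * a + δ * a) - (a + a)) ≡ K * ((K * h + ε) * b - a)
      scaled-slack = begin
        (ε * D) * (K * b + (δ * a + δ * a) - (a + a))
          ≡⟨ solve 6 (λ e d dl kk s o → (e :* d) :* (kk :* s :+ (dl :* o :+ dl :* o) :- (o :+ o))
                       := (e :* d) :* kk :* s :- con (pos 2) :* (e :* d) :* o :+ con (pos 2) :* e :* (d :* dl) :* o)
                     refl ε D δ K b a ⟩
        expand D (D * δ)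
          ≡⟨ cong₂ expand (cong (_+ K * q) (sym (+-identityʳ 1ℝ))) (inverse 0<D) ⟩
        expand (one + K * q) one
          ≡⟨ solve 5 (λ e kk q s o → (e :* (con (pos 1) :+ kk :* q)) :* kk :* s :- con (pos 2) :* (e :* (con (pos 1) :+ kk :* q)) :* o
                                       :+ con (pos 2) :* e :* con (pos 1) :* o
                                     := e :* kk :* s :+ kk :* kk :* (e :* q) :* s :- kk :* (con (pos 2) :* (e :* q)) :* o)
                     refl ε K q b a ⟩
        collect (ε * q)
          ≡⟨ cong collect εq≡h ⟩
        collect h
          ≡⟨ cong (λ z → ε * K * b + K * K * h * b - K * z * a) (inverse 0<two) ⟩
        ε * K * b + K * K * h * b - K * one * a
          ≡⟨ solve 5 (λ e kk h s o → e :* kk :* s :+ kk :* kk :* h :* s :- kk :* con (pos 1) :* o := kk :* ((kk :* h :+ e) :* s :- o))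
                     refl ε K h b a ⟩
        K * ((K * h + ε) * b - a) ∎
        where open ≡-Reasoning

  -- Multiplying the slack K b + 2 δ a - 2 a ≥ 0 by ε (1 + K / 2ε) = ε / δ > 0 gives K ((K / 2 + ε) b - a).
  absorb-slack : ∀ K ε a b → 0ℝ < K → 0ℝ < ε →
    a + a ≤ K * b + ((1ℝ + K / (fromℕ 2 * ε)) ⁻¹ * a + (1ℝ + K / (fromℕ 2 * ε)) ⁻¹ * a) →
    a ≤ (K / fromℕ 2 + ε) * b
  absorb-slack K ε a b 0<K 0<ε 2a≤ = 0≤y-x⇒x≤y (*-cancelˡ-nonNeg 0<K
    (subst (0ℝ ≤_) scaled-slack (*-nonNeg (*-nonNeg (inj₁ 0<ε) (inj₁ 0<D)) (x≤y⇒0≤y-x 2a≤))))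
    where open SlackAlgebra K ε a b 0<K 0<ε

  module Marginals {n} (f : Subset n → R) (f-mono : SF.Monotone f) (f-submodular : SF.Submodular f) where

    marginal : Subset n → Fin n → R
    marginal X t = f (X ∪ ⁅ t ⁆) - f X

    marginal-nonNeg : ∀ X t → 0ℝ ≤ marginal X t
    marginal-nonNeg X t = x≤y⇒0≤y-x (f-mono (p⊆p∪q ⁅ t ⁆))

    marginal-antitone : ∀ {X Y} a → X ⊆ Y → Y ! a ≡ false → marginal Y a ≤ marginal X a
    marginal-antitone {X} {Y} a X⊆Y a∉Y =
      ≤-viaDifference _ (solve 4 (λ u v x y → (x :- u) :- (y :- v) := (x :+ v) :- (y :+ u)) refl (f X) (f Y) (f (X ∪ ⁅ a ⁆)) (f (Y ∪ ⁅ a ⁆)))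
        (x≤y⇒0≤y-x (subst₂ (λ U V → f U + f V ≤ f (X ∪ ⁅ a ⁆) + f Y) union intersection (f-submodular (X ∪ ⁅ a ⁆) Y)))
      where
      union : (X ∪ ⁅ a ⁆) ∪ Y ≡ Y ∪ ⁅ a ⁆
      union = subset-ext λ i → trans (lookup-∪ (X ∪ ⁅ a ⁆) Y i) (trans (cong (_∨ Y ! i) (lookup-∪ X ⁅ a ⁆ i))
        (trans (pointwise (X ! i) (⁅ a ⁆ ! i) (Y ! i) (⊆⇒lookup X⊆Y)) (sym (lookup-∪ Y ⁅ a ⁆ i))))
        where
        pointwise : ∀ x e y → (x ≡ true → y ≡ true) → (x ∨ e) ∨ y ≡ y ∨ e
        pointwise true  e y x⇒y rewrite x⇒y refl = refl
        pointwise false e y _   = Bool.∨-comm e y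
      intersection : (X ∪ ⁅ a ⁆) ∩ Y ≡ X
      intersection = subset-ext λ i → trans (lookup-∩ (X ∪ ⁅ a ⁆) Y i) (trans (cong (_∧ Y ! i) (lookup-∪ X ⁅ a ⁆ i))
        (pointwise (X ! i) (⁅ a ⁆ ! i) (Y ! i) (⊆⇒lookup X⊆Y)
                   (λ i∈a → subst (λ j → Y ! j ≡ false) (sym (lookup-⁅y⁆⇒≡ a i∈a)) a∉Y)))
        where
        pointwise : ∀ x e y → (x ≡ true → y ≡ true) → (e ≡ true → y ≡ false) → (x ∨ e) ∧ y ≡ x
        pointwise true  e     y x⇒y _   rewrite x⇒y refl = refl
        pointwise false true  y _   e⇒¬y rewrite e⇒¬y refl = refl
        pointwise false false y _   _   = refl

  module Analysis (k : ℕ) (1≤k : 1 ℕ.≤ k) {n} {ℐ : Subset n → Set} (exchange-system : ExchangeSystem k n ℐ)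
                  {f : Subset n → R} (f-nonNeg : SF.NonNegative f) (f-mono : SF.Monotone f)
                  (f-submodular : SF.Submodular f) {ε} (0<ε : 0ℝ < ε)
                  {e*} (ℐ⁅e*⁆ : ℐ ⁅ e* ⁆) (e*-max : ∀ e → ℐ ⁅ e ⁆ → f ⁅ e ⁆ ≤ f ⁅ e* ⁆) where

    open Marginals f f-mono f-submodular
    open ExchangeSystem exchange-system
    open IndependenceSystem isIndependenceSystem

    α : R
    α = SF.alpha f e* k ε

    δ : R
    δ = SF.delta k ε

    module N = NOLS ℝ ℐ f k α

    0<δ : 0ℝ < δ
    0<δ = ⁻¹-pos (+-pos-nonNeg 0<1 (*-nonNeg (fromℕ-nonNeg (k ℕ.+ 3)) (inj₁ (⁻¹-pos (*-pos (fromℕ-pos 1) 0<ε)))))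

    0<n : 0ℝ < fromℕ n
    0<n = Fin⇒0<fromℕ e*

    0≤α : 0ℝ ≤ α
    0≤α = *-nonNeg (*-nonNeg (f-nonNeg ⁅ e* ⁆) (inj₁ 0<δ)) (inj₁ (⁻¹-pos 0<n))

    α-pos-or-trivial : 0ℝ < α ⊎ f ⁅ e* ⁆ ≡ 0ℝ
    α-pos-or-trivial with f-nonNeg ⁅ e* ⁆
    ... | inj₁ 0<f⁅e*⁆ = inj₁ (*-pos (*-pos 0<f⁅e*⁆ 0<δ) (⁻¹-pos 0<n))
    ... | inj₂ 0≡f⁅e*⁆ = inj₂ (sym 0≡f⁅e*⁆)

    nα≡f⁅e*⁆δ : fromℕ n * α ≡ f ⁅ e* ⁆ * δ
    nα≡f⁅e*⁆δ = trans (*-comm _ _) (trans (*-assoc _ _ _)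
      (trans (cong (f ⁅ e* ⁆ * δ *_) (trans (*-comm _ _) (⁻¹-inverse _ (pos⇒≢0 0<n)))) (*-identityʳ _)))

    sumFin≡∑ : ∀ {m} (g : Fin m → R) → N.sumFin g ≡ ∑ g
    sumFin≡∑ {zero}  g = refl
    sumFin≡∑ {suc m} g = cong (g Fin.zero +_) (sumFin≡∑ (g ∘ Fin.suc))

    module AtLocalOptimum {S : Subset n} {rank : Fin n → ℕ} (rank-injective : Injective _≡_ _≡_ rank)
                          (ℐS : ℐ S) (terminal : N.Terminal N.⟨ S , rank , rank-injective ⟩)
                          {O : Subset n} (ℐO : ℐ O) (O-max : ∀ X → ℐ X → f X ≤ f O) where

      w : Fin n → R
      w = N.w S rank

      wRep : Subset n → Subset n → Fin n → R
      wRep = N.wRep S rank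

      0≤w : ∀ t → 0ℝ ≤ w t
      0≤w t = roundDown-nonNeg _ 0≤α (marginal-nonNeg _ t)

      0≤wRep : ∀ A B a → 0ℝ ≤ wRep A B a
      0≤wRep A B a = roundDown-nonNeg _ 0≤α
        (subst (λ U → 0ℝ ≤ f U - f ((S ─ B) ∪ before rank A a)) (∪-assoc (S ─ B) _ ⁅ a ⁆) (marginal-nonNeg _ a))

      ∑w≤fS : ∑[ S ] w ≤ f S
      ∑w≤fS = begin
        ∑[ S ] w                                     ≤⟨ ∑[]-mono S (λ t _ → roundDown≤z _ 0≤α (marginal-nonNeg _ t)) ⟩
        ∑[ S ] (gain rank rank-injective f S)        ≡⟨ ∑-gain rank rank-injective f S ⟩
        f S - f ⊥                                    ≤⟨ x-y≤x (f-nonNeg ⊥) ⟩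
        f S                                          ∎
        where open ≤-Reasoning

      squares≤ : ∀ {A B} → N.IsReplacement S A B →
                 ∑[ A ] (λ a → wRep A B a * wRep A B a) ≤ ∑[ B ] (λ b → w b * w b)
      squares≤ {A} {B} replacement = subst₂ _≤_ (sumFin≡∑ {n} _) (sumFin≡∑ {n} _) (≮⇒≥ (terminal A B replacement))

      v : Fin n → R
      v = gain rank rank-injective (λ Y → f (S ∪ Y)) (O ─ S)

      ∑v≡ : ∑[ O ─ S ] v ≡ f (S ∪ (O ─ S)) - f S
      ∑v≡ = trans (∑-gain rank rank-injective (λ Y → f (S ∪ Y)) (O ─ S)) (cong (λ Z → f (S ∪ (O ─ S)) - f Z) (∪-identityʳ S))

      fO≤f[S∪O─S] : f O ≤ f (S ∪ (O ─ S))
      fO≤f[S∪O─S] = f-mono (lookup⇒⊆ λ i i∈O → trans (lookup-∪ S (O ─ S) i)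
        (pointwise (S ! i) (trans (sym (cong (_∧ not (S ! i)) i∈O)) (sym (lookup-─ O S i)))))
        where
        pointwise : ∀ s {d} → true ∧ not s ≡ d → s ∨ d ≡ true
        pointwise true  _    = refl
        pointwise false refl = refl

      private
        module _ {o} (o∈O─S : (O ─ S) ! o ≡ true) where
          below : Subset n
          below = S ∪ before rank (O ─ S) o

          v≡marginal : v o ≡ marginal below o
          v≡marginal = cong (λ U → f U - f below) (sym (∪-assoc S (before rank (O ─ S) o) ⁅ o ⁆))

          o∉below : below ! o ≡ false
          o∉below = trans (lookup-∪ S _ o) (cong₂ _∨_ (proj₂ (lookup-─⇒ O S o∈O─S)) (s∉before rank (O ─ S) o))

      -- The gain of o ∈ A ⊆ O ∖ S on top of S dominates, by submodularity, its gain in the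
      -- replacement (A , B); rounding costs at most α.
      v≤wRep+α : ∀ A B {o} → A ⊆ O ─ S → A ! o ≡ true → v o ≤ wRep A B o + α
      v≤wRep+α A B {o} A⊆O─S o∈A with α-pos-or-trivial
      ... | inj₁ 0<α = begin
        v o                           ≡⟨ v≡marginal o∈O─S ⟩
        marginal (below o∈O─S) o      ≤⟨ marginal-antitone o X⊆below (o∉below o∈O─S) ⟩
        marginal X o                  ≤⟨ x-z≤y⇒x≤y+z (z-α≤roundDown (marginal X o) 0<α) ⟩
        roundDown α (marginal X o) + α ≡⟨ cong (λ U → roundDown α (f U - f X) + α) (∪-assoc (S ─ B) _ ⁅ o ⁆) ⟩
        wRep A B o + α                ∎
        where
        open ≤-Reasoning
        o∈O─S : (O ─ S) ! o ≡ true
        o∈O─S = ⊆⇒lookup A⊆O─S o∈A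
        X : Subset n
        X = (S ─ B) ∪ before rank A o
        X⊆below : X ⊆ below o∈O─S
        X⊆below = ∪-mono-⊆ (p─q⊆p S B) (before-mono rank o A⊆O─S)
      ... | inj₂ f⁅e*⁆≡0 = ≤-trans v≤0 (+-nonNeg (0≤wRep A B o) 0≤α)
        where
        o∈O─S : (O ─ S) ! o ≡ true
        o∈O─S = ⊆⇒lookup A⊆O─S o∈A
        ℐ⁅o⁆ : ℐ ⁅ o ⁆
        ℐ⁅o⁆ = downClosed (lookup⇒⊆ λ i i∈o → subst (λ j → O ! j ≡ true) (sym (lookup-⁅y⁆⇒≡ o i∈o))
                  (proj₁ (lookup-─⇒ O S o∈O─S))) ℐO
        v≤0 : v o ≤ 0ℝ
        v≤0 = begin
          v o                      ≡⟨ v≡marginal o∈O─S ⟩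
          marginal (below o∈O─S) o ≤⟨ marginal-antitone o ⊥⊆ (o∉below o∈O─S) ⟩
          f (⊥ ∪ ⁅ o ⁆) - f ⊥      ≡⟨ cong (λ U → f U - f ⊥) (∪-identityˡ ⁅ o ⁆) ⟩
          f ⁅ o ⁆ - f ⊥            ≤⟨ x-y≤x (f-nonNeg ⊥) ⟩
          f ⁅ o ⁆                  ≤⟨ e*-max o ℐ⁅o⁆ ⟩
          f ⁅ e* ⁆                 ≡⟨ f⁅e*⁆≡0 ⟩
          0ℝ                       ∎
          where open ≤-Reasoning

      Y : Fin n → Subset n
      Y = proj₁ (exchange O S ℐO ℐS)

      Y⊆S─O : ∀ {o t} → (O ─ S) ! o ≡ true → Y o ! t ≡ true → (S ─ O) ! t ≡ true
      Y⊆S─O o∈O─S = ⊆⇒lookup (proj₁ (proj₁ (proj₂ (exchange O S ℐO ℐS)) _ (lookup⇒∈ o∈O─S)))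

      ∣Y∣≤k : ∀ {o} → (O ─ S) ! o ≡ true → ∣ Y o ∣ ℕ.≤ k
      ∣Y∣≤k o∈O─S = proj₂ (proj₁ (proj₂ (exchange O S ℐO ℐS)) _ (lookup⇒∈ o∈O─S))

      Y-multiplicity : Fin n → Subset n
      Y-multiplicity t = tabulate λ o → (O ─ S) ! o ∧ Y o ! t

      ∣Y-multiplicity∣≤k : ∀ {t} → (S ─ O) ! t ≡ true → ∣ Y-multiplicity t ∣ ℕ.≤ k
      ∣Y-multiplicity∣≤k t∈S─O = proj₁ (proj₂ (proj₂ (exchange O S ℐO ℐS))) _ (lookup⇒∈ t∈S─O)

      ℐ-exchange : ∀ C → C ⊆ O ─ S → ℐ ((S ─ (⋃[ C ] Y)) ∪ C)
      ℐ-exchange = proj₂ (proj₂ (proj₂ (exchange O S ℐO ℐS)))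

      Pivot : Fin n → Set
      Pivot o = (∀ t → Y o ! t ≡ false) ⊎ Σ (Fin n) λ s → Y o ! s ≡ true × (∀ t → Y o ! t ≡ true → w t ≤ w s)

      pivot? : ∀ o → Pivot o
      pivot? o = argmax (Y o !_) w

      private
        found : ∀ {o} → Pivot o → Bool
        found (inj₁ _) = false
        found (inj₂ _) = true

        chosen : ∀ {o} → Pivot o → Fin n
        chosen {o} (inj₁ _)       = o
        chosen     (inj₂ (s , _)) = s

      hasPivot : Fin n → Bool
      hasPivot o = found (pivot? o)

      pivot : Fin n → Fin n
      pivot o = chosen (pivot? o)

      pivot-spec : ∀ o → hasPivot o ≡ true → Y o ! pivot o ≡ true × (∀ t → Y o ! t ≡ true → w t ≤ w (pivot o))
      pivot-spec o has with pivot? o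
      ... | inj₂ (_ , s∈Y , s-max) = s∈Y , s-max

      no-pivot⇒Y≡∅ : ∀ o → hasPivot o ≡ false → ∀ t → Y o ! t ≡ false
      no-pivot⇒Y≡∅ o none with pivot? o
      ... | inj₁ Y≡∅ = Y≡∅

      pivoted : Fin n → Bool
      pivoted o = (O ─ S) ! o ∧ hasPivot o

      group : Fin n → Subset n
      group s = tabulate λ o → pivoted o ∧ does (pivot o ≟ s)

      groupY : Fin n → Subset n
      groupY s = ⋃[ group s ] Y

      ∈group⇒ : ∀ {s o} → group s ! o ≡ true → (O ─ S) ! o ≡ true × hasPivot o ≡ true × pivot o ≡ s
      ∈group⇒ {s} {o} o∈group with pivot o ≟ s | trans (sym (Vec.lookup∘tabulate _ o)) o∈group
      ... | yes refl | both = ∧≡true⇒ˡ (∧≡true⇒ˡ both) , ∧≡true⇒ʳ {(O ─ S) ! o} (∧≡true⇒ˡ both) , refl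
      ... | no _     | both with ∧≡true⇒ʳ {pivoted o} both
      ...   | ()

      group⊆O─S : ∀ s → group s ⊆ O ─ S
      group⊆O─S s = lookup⇒⊆ λ o o∈group → proj₁ (∈group⇒ o∈group)

      pivot∈Y : ∀ {s o} → group s ! o ≡ true → Y o ! s ≡ true
      pivot∈Y o∈group with ∈group⇒ o∈group
      ... | _ , has , refl = proj₁ (pivot-spec _ has)

      pivot-max : ∀ {s o} → group s ! o ≡ true → ∀ t → Y o ! t ≡ true → w t ≤ w s
      pivot-max o∈group with ∈group⇒ o∈group
      ... | _ , has , refl = proj₂ (pivot-spec _ has)

      pivot∈S─O : ∀ {s o} → group s ! o ≡ true → (S ─ O) ! s ≡ true
      pivot∈S─O o∈group = Y⊆S─O (proj₁ (∈group⇒ o∈group)) (pivot∈Y o∈group)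

      ∑-groups : ∀ h → ∑ (λ s → ∑[ group s ] h) ≡ ∑ (λ o → when (pivoted o) (h o))
      ∑-groups h = trans (∑-comm {n} {n} (λ s o → when (group s ! o) (h o))) (∑-cong λ o → begin
        ∑ (λ s → when (group s ! o) (h o))                      ≡⟨ ∑-cong {n} (λ s → trans (cong (λ b → when b (h o)) (Vec.lookup∘tabulate _ o))
                                                                     (when-∧ (pivoted o) _ (h o))) ⟩
        ∑ (λ s → when (pivoted o) (when (does (pivot o ≟ s)) (h o))) ≡⟨ sym (when-∑ {n} (pivoted o) _) ⟩
        when (pivoted o) (∑ (λ s → when (does (pivot o ≟ s)) (h o))) ≡⟨ cong (when (pivoted o)) (trans (∑-single (pivot o) (others o)) (self o)) ⟩
        when (pivoted o) (h o)                                   ∎)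
        where
        open ≡-Reasoning
        self : ∀ o → when (does (pivot o ≟ pivot o)) (h o) ≡ h o
        self o with pivot o ≟ pivot o
        ... | yes _        = refl
        ... | no p≢p       = ⊥-elim (p≢p refl)
        others : ∀ o s → s ≢ pivot o → when (does (pivot o ≟ s)) (h o) ≡ 0ℝ
        others o s s≢p with pivot o ≟ s
        ... | yes p≡s = ⊥-elim (s≢p (sym p≡s))
        ... | no _    = refl

      ∣group∣≤k : ∀ {s} → (S ─ O) ! s ≡ true → ∣ group s ∣ ℕ.≤ k
      ∣group∣≤k {s} s∈S─O = ℕ.≤-trans (p⊆q⇒∣p∣≤∣q∣ {p = group s} {q = Y-multiplicity s} (lookup⇒⊆ λ o o∈group →
        trans (Vec.lookup∘tabulate _ o) (cong₂ _∧_ (proj₁ (∈group⇒ o∈group)) (pivot∈Y o∈group)))) (∣Y-multiplicity∣≤k s∈S─O)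

      -- Y o contains the pivot s for every o in the group, so the union counts s once and at most
      -- k - 1 further elements per member.
      ∣groupY∣≤ : ∀ {s} → (S ─ O) ! s ≡ true → ∣ groupY s ∣ ℕ.≤ k ℕ.* k ℕ.∸ k ℕ.+ 1
      ∣groupY∣≤ {s} s∈S─O with ℕ.m≤n⇒∃[o]m+o≡n 1≤k
      ... | k' , refl = fromℕ-cancel-≤ (begin
        fromℕ ∣ groupY s ∣                                   ≡⟨ fromℕ-∣p∣≡∑[p]1 (groupY s) ⟩
        ∑[ groupY s ] (λ _ → 1ℝ)                             ≤⟨ ∑[⋃]≤ (group s) Y (λ _ → 1ℝ) s (λ _ → inj₁ 0<1) ⟩
        1ℝ + ∑[ group s ] (λ o → ∑[ Y o ─ ⁅ s ⁆ ] (λ _ → 1ℝ)) ≤⟨ +-monoʳ-≤ 1ℝ (∑[]-mono (group s) (λ o → rest≤k' {o})) ⟩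
        1ℝ + ∑[ group s ] (λ _ → fromℕ k')                   ≡⟨ cong (1ℝ +_) (trans (∑[]-cong (group s) (λ o _ → sym (*-identityʳ (fromℕ k'))))
                                                                 (trans (∑[]-distribˡ (group s) (fromℕ k') (λ _ → 1ℝ))
                                                                        (cong (fromℕ k' *_) (sym (fromℕ-∣p∣≡∑[p]1 (group s)))))) ⟩
        1ℝ + fromℕ k' * fromℕ ∣ group s ∣                     ≤⟨ +-monoʳ-≤ 1ℝ (*-monoʳ-≤-nonNeg (fromℕ k') (fromℕ-nonNeg k')
                                                                 (fromℕ-mono-≤ (∣group∣≤k s∈S─O))) ⟩
        1ℝ + fromℕ k' * fromℕ (suc k')                        ≡⟨ sym bound-as-real ⟩
        fromℕ (suc k' ℕ.* suc k' ℕ.∸ suc k' ℕ.+ 1)           ∎)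
        where
        open ≤-Reasoning
        rest≤k' : ∀ {o} → group s ! o ≡ true → ∑[ Y o ─ ⁅ s ⁆ ] (λ _ → 1ℝ) ≤ fromℕ k'
        rest≤k' {o} o∈group = +-cancelʳ-≤ 1ℝ (begin
          ∑[ Y o ─ ⁅ s ⁆ ] (λ _ → 1ℝ) + 1ℝ ≡⟨ sym (∑[]-split (Y o) (λ _ → 1ℝ) s (pivot∈Y o∈group)) ⟩
          ∑[ Y o ] (λ _ → 1ℝ)             ≡⟨ sym (fromℕ-∣p∣≡∑[p]1 (Y o)) ⟩
          fromℕ ∣ Y o ∣                   ≤⟨ fromℕ-mono-≤ (∣Y∣≤k (proj₁ (∈group⇒ o∈group))) ⟩
          1ℝ + fromℕ k'                   ≡⟨ +-comm 1ℝ (fromℕ k') ⟩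
          fromℕ k' + 1ℝ                   ∎)
        bound-as-real : fromℕ (suc k' ℕ.* suc k' ℕ.∸ suc k' ℕ.+ 1) ≡ 1ℝ + fromℕ k' * fromℕ (suc k')
        bound-as-real = trans (cong (λ z → fromℕ (z ℕ.+ 1)) (ℕ.m+n∸m≡n (suc k') (k' ℕ.* suc k')))
          (trans (fromℕ-+ (k' ℕ.* suc k') 1) (trans (cong₂ _+_ (fromℕ-* k' (suc k')) (+-identityʳ 1ℝ)) (+-comm _ _)))

      group-replacement : ∀ {s} → (S ─ O) ! s ≡ true → N.IsReplacement S (group s) (groupY s)
      group-replacement {s} s∈S─O =
        lookup⇒⊆ groupY⊆S , lookup⇒⊆ group∉S─groupY , ∣group∣≤k s∈S─O , ∣groupY∣≤ s∈S─O ,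
        ℐ-exchange (group s) (group⊆O─S s)
        where
        groupY⊆S : ∀ t → groupY s ! t ≡ true → S ! t ≡ true
        groupY⊆S t t∈groupY with lookup-⋃ (group s) Y t∈groupY
        ... | o , o∈group , t∈Yo = proj₁ (lookup-─⇒ S O (Y⊆S─O (proj₁ (∈group⇒ o∈group)) t∈Yo))
        group∉S─groupY : ∀ o → group s ! o ≡ true → ∁ (S ─ groupY s) ! o ≡ true
        group∉S─groupY o o∈group = trans (lookup-∁ (S ─ groupY s) o) (cong not (trans (lookup-─ S (groupY s) o)
          (cong (_∧ not (groupY s ! o)) (proj₂ (lookup-─⇒ O S (proj₁ (∈group⇒ o∈group)))))))

      charge : Fin n → R
      charge o = ∑[ Y o ] w + (α + α)

      0≤charge : ∀ o → 0ℝ ≤ charge o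
      0≤charge o = +-nonNeg (∑[]-nonNeg (Y o) (λ t _ → 0≤w t)) (+-nonNeg 0≤α 0≤α)

      -- Local optimality against the replacement (group s , groupY s), through the square trick.
      group-bound : ∀ s → ∑[ group s ] (λ o → v o + v o) ≤ when (S ! s) (w s) + ∑[ group s ] charge
      group-bound s with any? (λ o → group s ! o Bool.≟ true)
      ... | no empty = subst (_≤ when (S ! s) (w s) + ∑[ group s ] charge) (sym (∑[]-empty (group s) _ group≡∅))
                         (+-nonNeg (when-nonNeg (S ! s) (0≤w s)) (∑[]-nonNeg (group s) (λ o _ → 0≤charge o)))
        where
        group≡∅ : ∀ o → group s ! o ≡ false
        group≡∅ o with group s ! o in o∈group
        ... | true  = ⊥-elim (empty (o , o∈group))
        ... | false = refl
      ... | yes (o₀ , o₀∈group) = begin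
        ∑[ group s ] (λ o → v o + v o)                            ≤⟨ ∑[]-mono (group s) (λ o o∈group →
                                                                       +-mono-≤ (v≤y+α o∈group) (v≤y+α o∈group)) ⟩
        ∑[ group s ] (λ o → (y o + α) + (y o + α))                ≡⟨ ∑[]-cong (group s) (λ o _ →
                                                                       solve 2 (λ y a → (y :+ a) :+ (y :+ a) := (y :+ y) :+ (a :+ a)) refl (y o) α) ⟩
        ∑[ group s ] (λ o → (y o + y o) + (α + α))                ≡⟨ trans (∑[]-+ (group s) _ _)
                                                                       (cong (_+ ∑[ group s ] (λ _ → α + α)) (∑[]-+ (group s) y y)) ⟩
        (∑[ group s ] y + ∑[ group s ] y) + ∑[ group s ] (λ _ → α + α)
                                                                  ≤⟨ +-monoˡ-≤ _ (twice-∑≤ (group s) Y w y s 0≤w (λ _ → pivot∈Y) (λ _ → pivot-max)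
                                                                       (squares≤ (group-replacement s∈S─O))) ⟩
        (w s + ∑[ group s ] (λ o → ∑[ Y o ] w)) + ∑[ group s ] (λ _ → α + α)
                                                                  ≡⟨ trans (+-assoc _ _ _) (cong₂ _+_ (cong (λ b → when b (w s)) (sym s∈S))
                                                                       (sym (∑[]-+ (group s) _ _))) ⟩
        when (S ! s) (w s) + ∑[ group s ] charge                  ∎
        where
        open ≤-Reasoning
        A B : Subset n
        A = group s
        B = groupY s
        y : Fin n → R
        y = wRep A B
        v≤y+α : ∀ {o} → group s ! o ≡ true → v o ≤ y o + α
        v≤y+α = v≤wRep+α A B (group⊆O─S s)
        s∈S─O : (S ─ O) ! s ≡ true
        s∈S─O = pivot∈S─O o₀∈group
        s∈S : S ! s ≡ true
        s∈S = proj₁ (lookup-─⇒ S O s∈S─O)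

      -- Without a pivot, ({o} , ∅) is a replacement, so the rounded gain of o is not positive.
      v≤α-without-pivot : ∀ {o} → (O ─ S) ! o ≡ true → hasPivot o ≡ false → v o ≤ α
      v≤α-without-pivot {o} o∈O─S none = begin
        v o                    ≤⟨ v≤wRep+α ⁅ o ⁆ B ⁅o⁆⊆O─S (lookup-⁅x⁆-x o) ⟩
        wRep ⁅ o ⁆ B o + α     ≤⟨ +-monoˡ-≤ α (square-nonPos⇒nonPos square≤0) ⟩
        0ℝ + α                 ≡⟨ +-identityˡ α ⟩
        α                      ∎
        where
        open ≤-Reasoning
        B : Subset n
        B = ⋃[ ⁅ o ⁆ ] Y
        B≡∅ : ∀ t → B ! t ≡ false
        B≡∅ t with B ! t in t∈B
        ... | false = refl
        ... | true with lookup-⋃ ⁅ o ⁆ Y t∈B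
        ...   | e , e∈o , t∈Ye rewrite lookup-⁅y⁆⇒≡ o e∈o = ⊥-elim (true≢false (trans (sym t∈Ye) (no-pivot⇒Y≡∅ o none t)))
        B≡⊥ : B ≡ ⊥
        B≡⊥ = subset-ext λ t → trans (B≡∅ t) (sym (lookup-⊥ t))
        ⁅o⁆⊆O─S : ⁅ o ⁆ ⊆ O ─ S
        ⁅o⁆⊆O─S = lookup⇒⊆ λ i i∈o → subst (λ j → (O ─ S) ! j ≡ true) (sym (lookup-⁅y⁆⇒≡ o i∈o)) o∈O─S
        replacement : N.IsReplacement S ⁅ o ⁆ B
        replacement = lookup⇒⊆ (λ t t∈B → ⊥-elim (true≢false (trans (sym t∈B) (B≡∅ t))))
                    , lookup⇒⊆ (λ i i∈o → subst (λ j → ∁ (S ─ B) ! j ≡ true) (sym (lookup-⁅y⁆⇒≡ o i∈o))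
                        (trans (lookup-∁ (S ─ B) o) (cong not (trans (lookup-─ S B o)
                          (cong (_∧ not (B ! o)) (proj₂ (lookup-─⇒ O S o∈O─S)))))))
                    , subst (ℕ._≤ k) (sym (∣⁅x⁆∣≡1 o)) 1≤k
                    , subst (ℕ._≤ k ℕ.* k ℕ.∸ k ℕ.+ 1) (sym (trans (cong ∣_∣ B≡⊥) (∣⊥∣≡0 n))) ℕ.z≤n
                    , ℐ-exchange ⁅ o ⁆ ⁅o⁆⊆O─S
        square≤0 : wRep ⁅ o ⁆ B o * wRep ⁅ o ⁆ B o ≤ 0ℝ
        square≤0 = begin
          wRep ⁅ o ⁆ B o * wRep ⁅ o ⁆ B o                  ≡⟨ sym (∑[⁅u⁆] (λ i → wRep ⁅ o ⁆ B i * wRep ⁅ o ⁆ B i) o) ⟩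
          ∑[ ⁅ o ⁆ ] (λ i → wRep ⁅ o ⁆ B i * wRep ⁅ o ⁆ B i) ≤⟨ squares≤ replacement ⟩
          ∑[ B ] (λ t → w t * w t)                         ≡⟨ ∑[]-empty B _ B≡∅ ⟩
          0ℝ                                               ∎

      twice-∑v≤ : ∑[ O ─ S ] (λ o → v o + v o) ≤ ∑[ S ] w + ∑[ O ─ S ] charge
      twice-∑v≤ = begin
        ∑[ O ─ S ] (λ o → v o + v o)                              ≡⟨ trans (∑-cong (λ o → split o (v o + v o))) (∑-+ {n} _ _) ⟩
        ∑ (λ o → when (pivoted o) (v o + v o)) + ∑ (λ o → when (unpivoted o) (v o + v o))
                                                                  ≤⟨ +-mono-≤ pivoted-part unpivoted-part ⟩
        (∑[ S ] w + ∑ (λ o → when (pivoted o) (charge o))) + ∑ (λ o → when (unpivoted o) (charge o))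
                                                                  ≡⟨ trans (+-assoc _ _ _) (cong (∑[ S ] w +_) (trans (sym (∑-+ {n} _ _))
                                                                       (sym (∑-cong (λ o → split o (charge o)))))) ⟩
        ∑[ S ] w + ∑[ O ─ S ] charge                              ∎
        where
        open ≤-Reasoning
        unpivoted : Fin n → Bool
        unpivoted o = (O ─ S) ! o ∧ not (hasPivot o)
        split : ∀ o z → when ((O ─ S) ! o) z ≡ when (pivoted o) z + when (unpivoted o) z
        split o z with (O ─ S) ! o | hasPivot o
        ... | true  | true  = sym (+-identityʳ z)
        ... | true  | false = sym (+-identityˡ z)
        ... | false | _     = sym (+-identityˡ 0ℝ)
        pivoted-part : ∑ (λ o → when (pivoted o) (v o + v o)) ≤ ∑[ S ] w + ∑ (λ o → when (pivoted o) (charge o))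
        pivoted-part = begin
          ∑ (λ o → when (pivoted o) (v o + v o))     ≡⟨ sym (∑-groups (λ o → v o + v o)) ⟩
          ∑ (λ s → ∑[ group s ] (λ o → v o + v o))   ≤⟨ ∑-mono group-bound ⟩
          ∑ (λ s → when (S ! s) (w s) + ∑[ group s ] charge)
                                                     ≡⟨ trans (∑-+ {n} _ _) (cong (∑[ S ] w +_) (∑-groups charge)) ⟩
          ∑[ S ] w + ∑ (λ o → when (pivoted o) (charge o)) ∎
        unpivoted-part : ∑ (λ o → when (unpivoted o) (v o + v o)) ≤ ∑ (λ o → when (unpivoted o) (charge o))
        unpivoted-part = ∑-mono λ o → when-mono-⇒ (unpivoted o) λ o-unpivoted →
          let v≤α = v≤α-without-pivot (∧≡true⇒ˡ o-unpivoted) (not≡true⇒ (∧≡true⇒ʳ {(O ─ S) ! o} o-unpivoted)) in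
          ≤-trans (+-mono-≤ v≤α v≤α) (subst (_≤ charge o) (+-identityˡ _) (+-monoˡ-≤ (α + α) (∑[]-nonNeg (Y o) (λ t _ → 0≤w t))))

      ∑∑Y≤k∑w : ∑[ O ─ S ] (λ o → ∑[ Y o ] w) ≤ fromℕ k * ∑[ S ] w
      ∑∑Y≤k∑w = begin
        ∑[ O ─ S ] (λ o → ∑[ Y o ] w)                         ≡⟨ trans (∑-cong (λ o → when-∑ {n} ((O ─ S) ! o) _))
                                                                   (∑-comm {n} {n} (λ o t → when ((O ─ S) ! o) (when (Y o ! t) (w t)))) ⟩
        ∑ (λ t → ∑ (λ o → when ((O ─ S) ! o) (when (Y o ! t) (w t)))) ≤⟨ ∑-mono multiplicity ⟩
        ∑ (λ t → fromℕ k * when (S ! t) (w t))                ≡⟨ ∑-distribˡ {n} (fromℕ k) _ ⟩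
        fromℕ k * ∑[ S ] w                                    ∎
        where
        open ≤-Reasoning
        multiplicity : ∀ t → ∑ (λ o → when ((O ─ S) ! o) (when (Y o ! t) (w t))) ≤ fromℕ k * when (S ! t) (w t)
        multiplicity t with (S ─ O) ! t in t∈S─O
        ... | true = begin
          ∑ (λ o → when ((O ─ S) ! o) (when (Y o ! t) (w t)))  ≡⟨ ∑-cong (λ o → trans (sym (when-∧ ((O ─ S) ! o) (Y o ! t) (w t)))
                                                                    (trans (when-1 _ (w t)) (*-comm _ _))) ⟩
          ∑ (λ o → w t * when ((O ─ S) ! o ∧ Y o ! t) 1ℝ)      ≡⟨ trans (∑-distribˡ {n} (w t) _) (cong (w t *_) (trans
                                                                    (∑-cong {n} (λ o → cong (λ b → when b 1ℝ) (sym (Vec.lookup∘tabulate (λ o → (O ─ S) ! o ∧ Y o ! t) o))))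
                                                                    (sym (fromℕ-∣p∣≡∑[p]1 (Y-multiplicity t))))) ⟩
          w t * fromℕ ∣ Y-multiplicity t ∣                      ≤⟨ *-monoʳ-≤-nonNeg (w t) (0≤w t) (fromℕ-mono-≤ (∣Y-multiplicity∣≤k t∈S─O)) ⟩
          w t * fromℕ k                                         ≡⟨ trans (*-comm _ _) (cong (λ b → fromℕ k * when b (w t))
                                                                    (sym (proj₁ (lookup-─⇒ S O t∈S─O)))) ⟩
          fromℕ k * when (S ! t) (w t)                          ∎
        ... | false = subst (_≤ fromℕ k * when (S ! t) (w t)) (sym (∑-≡0 outside))
                        (*-nonNeg (fromℕ-nonNeg k) (when-nonNeg (S ! t) (0≤w t)))
          where
          outside : ∀ o → when ((O ─ S) ! o) (when (Y o ! t) (w t)) ≡ 0ℝ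
          outside o with (O ─ S) ! o in o∈O─S | Y o ! t in t∈Yo
          ... | true  | true  = ⊥-elim (true≢false (trans (sym (Y⊆S─O o∈O─S t∈Yo)) t∈S─O))
          ... | true  | false = refl
          ... | false | _     = refl

      ∑[O─S]2α≤2nα : ∑[ O ─ S ] (λ _ → α + α) ≤ fromℕ n * (α + α)
      ∑[O─S]2α≤2nα = ≤-trans (∑-mono λ o → when-≤ ((O ─ S) ! o) (+-nonNeg 0≤α 0≤α)) (≤-reflexive (∑-const {n} (α + α)))

      twice-gain≤ : (f (S ∪ (O ─ S)) - f S) + (f (S ∪ (O ─ S)) - f S) ≤ ∑[ S ] w + (fromℕ k * ∑[ S ] w + fromℕ n * (α + α))
      twice-gain≤ = begin
        (f (S ∪ (O ─ S)) - f S) + (f (S ∪ (O ─ S)) - f S)   ≡⟨ trans (cong₂ _+_ (sym ∑v≡) (sym ∑v≡)) (sym (∑[]-+ (O ─ S) v v)) ⟩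
        ∑[ O ─ S ] (λ o → v o + v o)                        ≤⟨ twice-∑v≤ ⟩
        ∑[ S ] w + ∑[ O ─ S ] charge                        ≡⟨ cong (∑[ S ] w +_) (∑[]-+ (O ─ S) _ _) ⟩
        ∑[ S ] w + (∑[ O ─ S ] (λ o → ∑[ Y o ] w) + ∑[ O ─ S ] (λ _ → α + α))
                                                            ≤⟨ +-monoʳ-≤ (∑[ S ] w) (+-mono-≤ ∑∑Y≤k∑w ∑[O─S]2α≤2nα) ⟩
        ∑[ S ] w + (fromℕ k * ∑[ S ] w + fromℕ n * (α + α)) ∎
        where open ≤-Reasoning

      twice-fO≤ : f O + f O ≤ fromℕ (k ℕ.+ 3) * f S + (δ * f O + δ * f O)
      twice-fO≤ = begin
        f O + f O                                          ≤⟨ +-mono-≤ fO≤f[S∪O─S] fO≤f[S∪O─S] ⟩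
        f U + f U                                          ≡⟨ solve 2 (λ u s → u :+ u := (s :+ s) :+ ((u :- s) :+ (u :- s))) refl (f U) (f S) ⟩
        (f S + f S) + ((f U - f S) + (f U - f S))           ≤⟨ +-monoʳ-≤ _ twice-gain≤ ⟩
        (f S + f S) + (∑[ S ] w + (K * ∑[ S ] w + N * (α + α)))
                                                           ≡⟨ cong ((f S + f S) +_) (solve 4 (λ r kk nn a → r :+ (kk :* r :+ nn :* (a :+ a))
                                                                := (con (pos 1) :+ kk) :* r :+ (nn :* a :+ nn :* a)) refl (∑[ S ] w) K N α) ⟩
        (f S + f S) + ((fromℕ 1 + K) * ∑[ S ] w + (N * α + N * α))
                                                           ≤⟨ +-monoʳ-≤ _ (+-monoˡ-≤ _ (*-monoʳ-≤-nonNeg _ (+-nonNeg (fromℕ-nonNeg 1) (fromℕ-nonNeg k)) ∑w≤fS)) ⟩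
        (f S + f S) + ((fromℕ 1 + K) * f S + (N * α + N * α))    ≡⟨ cong (λ z → (f S + f S) + ((fromℕ 1 + K) * f S + (z + z))) (trans nα≡f⁅e*⁆δ (*-comm _ _)) ⟩
        (f S + f S) + ((fromℕ 1 + K) * f S + (δ * f ⁅ e* ⁆ + δ * f ⁅ e* ⁆))
                                                           ≤⟨ +-monoʳ-≤ _ (+-monoʳ-≤ _ (+-mono-≤ δf⁅e*⁆≤δfO δf⁅e*⁆≤δfO)) ⟩
        (f S + f S) + ((fromℕ 1 + K) * f S + (δ * f O + δ * f O)) ≡⟨ solve 3 (λ s kk d → (s :+ s) :+ ((con (pos 1) :+ kk) :* s :+ d)
                                                                := (kk :+ con (pos 3)) :* s :+ d) refl (f S) K (δ * f O + δ * f O) ⟩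
        (K + fromℕ 3) * f S + (δ * f O + δ * f O)          ≡⟨ cong (λ z → z * f S + (δ * f O + δ * f O)) (sym (fromℕ-+ k 3)) ⟩
        fromℕ (k ℕ.+ 3) * f S + (δ * f O + δ * f O)        ∎
        where
        open ≤-Reasoning
        U : Subset n
        U = S ∪ (O ─ S)
        K N : R
        K = fromℕ k
        N = fromℕ n
        δf⁅e*⁆≤δfO : δ * f ⁅ e* ⁆ ≤ δ * f O
        δf⁅e*⁆≤δfO = *-monoʳ-≤-nonNeg δ (inj₁ 0<δ) (O-max ⁅ e* ⁆ ℐ⁅e*⁆)

      approximation : f O ≤ (fromℕ (k ℕ.+ 3) / fromℕ 2 + ε) * f S
      approximation = absorb-slack (fromℕ (k ℕ.+ 3)) ε (f O) (f S) 0<k+3 0<ε twice-fO≤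
        where
        0<k+3 : 0ℝ < fromℕ (k ℕ.+ 3)
        0<k+3 = subst (λ m → 0ℝ < fromℕ m) (sym (ℕ.+-suc k 2)) (fromℕ-pos (k ℕ.+ 2))

  Star-Step-preserves-ℐ : ∀ {n} {ℐ : Subset n → Set} {f k α} → let module N = NOLS ℝ ℐ f k α in
                          ∀ {σ τ} → Star N.Step σ τ → ℐ (N.sol σ) → ℐ (N.sol τ)
  Star-Step-preserves-ℐ Star.ε                                 ℐσ = ℐσ
  Star-Step-preserves-ℐ {ℐ = ℐ} ((_ , _ , replacement , _ , sol≡ , _) ◅ run) ℐσ =
    Star-Step-preserves-ℐ run (subst ℐ (sym sol≡) (proj₂ (proj₂ (proj₂ (proj₂ replacement)))))

open RealField {{...}}

theorem4 : {{ℝ : RealField}} →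
    (k : ℕ) → 1 ≤ℕ k → (n : ℕ) → (ℐ : Subset n → Set) → ExchangeSystem k n ℐ →
    (f : Subset n → R) →
    SetFunctions.NonNegative ℝ f → SetFunctions.Monotone ℝ f → SetFunctions.Submodular ℝ f →
    (ε : R) → 0ℝ < ε → ε < 1ℝ →
    (e* : Fin n) → ℐ ⁅ e* ⁆ → (∀ e → ℐ ⁅ e ⁆ → f ⁅ e ⁆ ≤ f ⁅ e* ⁆) →
    (rank₀ : Fin n → ℕ) → (inj : Injective _≡_ _≡_ rank₀) →
    (S : Subset n) → NOLS.Returns ℝ ℐ f k (SetFunctions.alpha ℝ f e* k ε) e* rank₀ inj S →
    (O : Subset n) → ℐ O → (∀ X → ℐ X → f X ≤ f O) →
    f O ≤ (fromℕ (k +ℕ 3) / fromℕ 2 + ε) * f S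
theorem4 {{ℝ}} k 1≤k n ℐ exchange-system f f-nonNeg f-mono f-submodular ε 0<ε _ e* ℐ⁅e*⁆ e*-max
         rank₀ inj .(NOLS.sol σ) (σ , run , terminal , refl) O ℐO O-max =
  AtLocalOptimum.approximation (NOLS.rankInj σ) (Star-Step-preserves-ℐ run ℐ⁅e*⁆) terminal ℐO O-max
  where
  open LocalSearch ℝ
  open Analysis k 1≤k exchange-system f-nonNeg f-mono f-submodular 0<ε ℐ⁅e*⁆ e*-max
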